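{- For all $0<\delta<\alpha$ there exists $C_0$ such that for every $C\ge C_0$ and every integer $n\ge 2$ the following holds. Suppose $d$ is an integer with $\log n\le d<n$ such that $Cd$ is a positive integer, and $G$ is a graph on $N=Cdn$ vertices with minimum degree $\delta(G)\ge \alpha N$. Then for every $d$-regular graph $H$ with vertex set $[n]$, $G$ admits an $(H,\alpha-\delta)$-good partition.
   Context: All graphs are finite and simple. For a vertex $x$ and a vertex set $U$, $d(x,U)$ denotes the number of neighbours of $x$ in $U$. For disjoint vertex sets $A,B$, $G[A]$ is the induced subgraph on $A$ and $G[A,B]$ is the bipartite subgraph of $G$ consisting of all edges of $G$ between $A$ and $B$ (on vertex set $A\cup B$). Definition: let $H$ be a graph with vertex set $[t]$ and $\alpha>0$. An $(H,\alpha)$-good partition of a graph $G$ is a vertex partition $V(G)=V_1\cup\dots\cup V_t$ such that (1) $|V_1|=\dots=|V_t|=m$; (2) $\delta(G[V_i])\ge \alpha m$ for all $i\in[t]$; (3) $\delta(G[V_i,V_j])\ge \alpha m$ for all $i,j\in[t]$ with $ij\in E(H)$. -}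

module Defs where

open import Level using (0ℓ)
open import Data.Bool using (Bool; true; false; _∧_)
open import Data.Nat as ℕ using (ℕ; zero; suc; _+_; _*_; _^_; _!)
open import Data.Integer using (+_)
open import Data.Rational as ℚ using (ℚ; _/_; 0ℚ)
open import Data.Fin using (Fin)
open import Data.Fin.Subset using (Subset; ∣_∣)
open import Data.Vec using (tabulate; lookup)
open import Data.Product using (Σ; ∃; _×_)
open import Data.Sum using (_⊎_)
open import Relation.Nullary using (¬_)
open import Relation.Binary.PropositionalEquality using (_≡_)

record ℝ : Set₁ where
  field
    L U       : ℚ → Set
    L-inhab   : ∃ L
    U-inhab   : ∃ U
    L-down    : ∀ {p q} → p ℚ.< q → L q → L p
    L-open    : ∀ {q} → L q → ∃ λ r → q ℚ.< r × L r
    U-up      : ∀ {p q} → p ℚ.< q → U p → U q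
    U-open    : ∀ {q} → U q → ∃ λ r → r ℚ.< q × U r
    disjoint  : ∀ q → ¬ (L q × U q)
    located   : ∀ {p q} → p ℚ.< q → L p ⊎ U q
open ℝ public

toℚ : ℕ → ℚ
toℚ n = (+ n) / 1

0<ℝ : ℝ → Set
0<ℝ x = ∃ λ q → 0ℚ ℚ.≤ q × L x q

_<ℝ_ : ℝ → ℝ → Set
x <ℝ y = ∃ λ q → U x q × L y q

_≥[_]·_ : ℕ → ℝ → ℕ → Set
k ≥[ α ]· N = ∀ q → L α q → q ℚ.* toℚ N ℚ.≤ toℚ k

_≥[_-_]·_ : ℕ → ℝ → ℝ → ℕ → Set
k ≥[ α - δ ]· m = ∀ a b → L α a → U δ b → (a ℚ.- b) ℚ.* toℚ m ℚ.≤ toℚ k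

-- log n ≤ d  (natural logarithm), i.e. n ≤ e^d = Σ_k d^k / k!.
-- expScaled d K = K! · Σ_{k ≤ K} d^k / k!  (a natural number).
-- n ≤ e^d iff some partial sum reaches n (for d ≥ 1, e^d is irrational;
-- for d = 0 both sides say n ≤ 1).

expScaled : ℕ → ℕ → ℕ
expScaled d zero    = 1
expScaled d (suc K) = suc K * expScaled d K + d ^ suc K

LogLe : ℕ → ℕ → Set
LogLe n d = ∃ λ K → n * (K !) ℕ.≤ expScaled d K

record Graph (n : ℕ) : Set where
  field
    adj   : Fin n → Fin n → Bool
    sym   : ∀ i j → adj i j ≡ adj j i
    irrefl : ∀ i → adj i i ≡ false
open Graph public

deg : ∀ {n} → Graph n → Fin n → Subset n → ℕ
deg G x U = ∣ tabulate (λ y → adj G x y ∧ lookup U y) ∣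

all : ∀ {n} → Subset n
all = tabulate (λ _ → true)

Regular : ∀ {n} → ℕ → Graph n → Set
Regular d H = ∀ x → deg H x all ≡ d

MinDegGe : ∀ {N} → Graph N → ℝ → ℕ → Set
MinDegGe G α N = ∀ x → deg G x all ≥[ α ]· N

part : ∀ {N t} → (Fin N → Fin t) → Fin t → Subset N
part {N} f i = tabulate (λ v → isEq (f v))
  where
  open import Data.Fin using (_≟_)
  open import Relation.Nullary using (does)
  isEq : Fin _ → Bool
  isEq j = does (j ≟ i)

record GoodPartition {N t : ℕ} (G : Graph N) (H : Graph t) (α δ : ℝ) : Set where
  field
    f     : Fin N → Fin t
    m     : ℕ
    size  : ∀ i → ∣ part f i ∣ ≡ m
    inner : ∀ i v → f v ≡ i → deg G v (part f i) ≥[ α - δ ]· m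
    -- δ(G[V_i, V_j]) ≥ (α − δ) m for ij ∈ E(H) (both sides, as H is symmetric)
    cross : ∀ i j → adj H i j ≡ true → ∀ v → f v ≡ i → deg G v (part f j) ≥[ α - δ ]· m

-- Cut the N = K n vertices into K blocks of n and send the k-th vertex of block g to part
-- k + s g (mod n), for a shift s : [K] → [n].  Every part then has exactly K vertices, and the
-- number of neighbours of a vertex v in a part is a sum of K independent indicators with mean
-- deg v / n.  An exponential-moment (Chernoff) bound shows that fewer than a 1/(K n²) fraction
-- of the shifts leave v with fewer than deg v / n - K/c neighbours in a given part, because
-- K ≥ C₀ d and log n ≤ d.  A union bound over the K n² pairs (v, part) yields a shift in which
-- every vertex has at least (α - δ) K neighbours in every part (with 1/c < δ), so the
-- partition is good for every graph H.

module Submission where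

open import Data.Nat hiding (_≟_)
open import Data.Nat.Properties hiding (_≟_)
open import Data.Nat.DivMod
open import Data.Nat.Tactic.RingSolver using (solve-∀)
import Data.Nat.Coprimality as Coprime
import Data.Integer as ℤ
import Data.Integer.Properties as ℤ
open import Data.Rational as ℚ using (ℚ)
import Data.Rational.Properties as ℚ
open import Data.Rational.Unnormalised as ℚᵘ using (ℚᵘ; mkℚᵘ; _≃_; *≡*; *≤*; *<*; 0ℚᵘ; 1ℚᵘ)
  renaming (_*_ to _*ᵘ_; _+_ to _+ᵘ_; _-_ to _-ᵘ_; -_ to -ᵘ_; _≤_ to _≤ᵘ_; _<_ to _<ᵘ_)
import Data.Rational.Unnormalised.Properties as ℚᵘ
open import Data.Rational.Unnormalised.Solver using (module +-*-Solver)
open import Data.Bool using (Bool; true; false; _∧_)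
open import Data.Bool.Properties using (∧-comm; ∧-identityʳ)
open import Data.Fin using (Fin; zero; suc; toℕ; fromℕ<; _≟_; _↑ˡ_; _↑ʳ_; combine; quotient; remainder)
open import Data.Fin.Properties using (toℕ-fromℕ<; toℕ-injective; toℕ<n; remQuot-combine)
open import Data.Fin.Permutation using (permutation)
open import Data.Fin.Subset using (∣_∣)
open import Data.Vec using (tabulate; lookup)
open import Data.Vec.Properties using (lookup∘tabulate)
open import Data.Vec.Functional using (_∷_)
open import Data.Product using (∃; _,_; proj₁; proj₂)
open import Data.Empty using (⊥-elim)
open import Function.Bundles using (mk⇔)
open import Relation.Nullary using (Dec; does; yes; no)
open import Relation.Nullary.Decidable using (dec-true; dec-false; does-⇔)
open import Relation.Binary.Definitions using (tri<; tri≈; tri>)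
open import Relation.Binary.PropositionalEquality
open import Algebra.Properties.Semiring.Sum +-*-semiring
  using (sum; sum-syntax; sum-cong-≗; ∑-distrib-+; ∑-comm; ∑-permute; *-distribˡ-sum; *-distribʳ-sum)
open import Algebra.Properties.CommutativeMonoid.Sum *-1-commutativeMonoid
  using () renaming (sum to prod; ∑-distrib-+ to prod-distrib-*)
open import Defs
  using (ℝ; L; U; L-down; L-open; disjoint; 0<ℝ; _<ℝ_; toℚ; _≥[_-_]·_; expScaled; LogLe;
         Graph; adj; deg; all; part; Regular; MinDegGe; GoodPartition)

^-distribʳ-* : ∀ m n o → (m * n) ^ o ≡ m ^ o * n ^ o
^-distribʳ-* m n zero    = refl
^-distribʳ-* m n (suc o) = trans (cong (m * n *_) (^-distribʳ-* m n o)) (interchange m n (m ^ o) (n ^ o))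
  where
  interchange : ∀ a b x y → a * b * (x * y) ≡ a * x * (b * y)
  interchange = solve-∀

^-distribʳ-*₃ : ∀ a b d m → (a * b * d) ^ m ≡ a ^ m * b ^ m * d ^ m
^-distribʳ-*₃ a b d m = trans (^-distribʳ-* (a * b) d m) (cong (_* d ^ m) (^-distribʳ-* a b m))

pow-*-≤ : ∀ m {a b c d} → a * b ≤ c * d → a ^ m * b ^ m ≤ c ^ m * d ^ m
pow-*-≤ m {a} {b} {c} {d} ab≤cd =
  subst₂ _≤_ (^-distribʳ-* a b m) (^-distribʳ-* c d m) (^-monoˡ-≤ m ab≤cd)

^-cancelʳ-≤ : ∀ n {m o} .{{_ : NonZero n}} → m ^ n ≤ o ^ n → m ≤ o
^-cancelʳ-≤ n {m} {o} le with m ≤? o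
... | yes m≤o = m≤o
... | no  m≰o = ⊥-elim (<⇒≱ (^-monoˡ-< n (≰⇒> m≰o)) le)

^-cancelʳ-< : ∀ n {m o} → m ^ n < o ^ n → m < o
^-cancelʳ-< n {m} {o} lt with m <? o
... | yes m<o = m<o
... | no  m≮o = ⊥-elim (<⇒≱ lt (^-monoˡ-≤ n (≮⇒≥ m≮o)))

x^j*y^i≤y^j*x^i : ∀ {x y i j} → x ≤ y → i ≤ j → x ^ j * y ^ i ≤ y ^ j * x ^ i
x^j*y^i≤y^j*x^i {x} {y} {i} {j} x≤y i≤j = begin
  x ^ j * y ^ i                 ≡⟨ cong (λ z → x ^ z * y ^ i) (m+[n∸m]≡n i≤j) ⟨
  x ^ (i + l) * y ^ i           ≡⟨ cong (_* y ^ i) (^-distribˡ-+-* x i l) ⟩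
  x ^ i * x ^ l * y ^ i         ≤⟨ *-monoˡ-≤ (y ^ i) (*-monoʳ-≤ (x ^ i) (^-monoˡ-≤ l x≤y)) ⟩
  x ^ i * y ^ l * y ^ i         ≡⟨ e (x ^ i) (y ^ l) (y ^ i) ⟩
  y ^ i * y ^ l * x ^ i         ≡⟨ cong (_* x ^ i) (^-distribˡ-+-* y i l) ⟨
  y ^ (i + l) * x ^ i           ≡⟨ cong (λ z → y ^ z * x ^ i) (m+[n∸m]≡n i≤j) ⟩
  y ^ j * x ^ i                 ∎
  where
  open ≤-Reasoning
  l = j ∸ i
  e : ∀ a b c → a * b * c ≡ c * b * a
  e = solve-∀

n<2^n : ∀ n → n < 2 ^ n
n<2^n zero    = s≤s z≤n
n<2^n (suc n) = begin-strict
  suc n          ≤⟨ n<2^n n ⟩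
  2 ^ n          <⟨ m<m+n (2 ^ n) (m^n>0 2 n) ⟩
  2 ^ n + 2 ^ n  ≡⟨ cong (2 ^ n +_) (+-identityʳ (2 ^ n)) ⟨
  2 * 2 ^ n      ∎
  where open ≤-Reasoning

[3+2m]≤2^[2+m] : ∀ m → 3 + (m + m) ≤ 2 ^ (2 + m)
[3+2m]≤2^[2+m] zero    = s≤s (s≤s (s≤s z≤n))
[3+2m]≤2^[2+m] (suc m) = begin
  3 + (suc m + suc m)    ≡⟨ cong (4 +_) (+-suc m m) ⟩
  5 + (m + m)            ≤⟨ m≤m+n (5 + (m + m)) (1 + (m + m)) ⟩
  5 + (m + m) + (1 + (m + m)) ≡⟨ e m ⟩
  2 * (3 + (m + m))      ≤⟨ *-monoʳ-≤ 2 ([3+2m]≤2^[2+m] m) ⟩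
  2 * 2 ^ (2 + m)        ∎
  where
  open ≤-Reasoning
  e : ∀ m → 5 + (m + m) + (1 + (m + m)) ≡ 2 * (3 + (m + m))
  e = solve-∀

[1+x]*2^m≤2^x : ∀ m x → 2 + (m + m) ≤ x → suc x * 2 ^ m ≤ 2 ^ x
[1+x]*2^m≤2^x m x x≥ = subst (λ x → suc x * 2 ^ m ≤ 2 ^ x) (m+[n∸m]≡n x≥) (go (x ∸ (2 + (m + m))))
  where
  open ≤-Reasoning
  go : ∀ j → suc (2 + (m + m) + j) * 2 ^ m ≤ 2 ^ (2 + (m + m) + j)
  go zero    = begin
    suc (2 + (m + m) + 0) * 2 ^ m  ≡⟨ cong (λ z → suc z * 2 ^ m) (+-identityʳ (2 + (m + m))) ⟩
    (3 + (m + m)) * 2 ^ m          ≤⟨ *-monoˡ-≤ (2 ^ m) ([3+2m]≤2^[2+m] m) ⟩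
    2 ^ (2 + m) * 2 ^ m            ≡⟨ ^-distribˡ-+-* 2 (2 + m) m ⟨
    2 ^ (2 + m + m)                ≡⟨ cong (2 ^_) (e m) ⟩
    2 ^ (2 + (m + m) + 0)          ∎
    where
    e : ∀ m → 2 + m + m ≡ 2 + (m + m) + 0
    e = solve-∀
  go (suc j) = begin
    suc (x′ + suc j) * 2 ^ m   ≡⟨ cong (λ z → suc z * 2 ^ m) (+-suc x′ j) ⟩
    (2 + (x′ + j)) * 2 ^ m     ≤⟨ *-monoˡ-≤ (2 ^ m) (m≤m+n (2 + (x′ + j)) (x′ + j)) ⟩
    (2 + (x′ + j) + (x′ + j)) * 2 ^ m ≡⟨ e (x′ + j) (2 ^ m) ⟩
    2 * (suc (x′ + j) * 2 ^ m) ≤⟨ *-monoʳ-≤ 2 (go j) ⟩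
    2 * 2 ^ (x′ + j)           ≡⟨ cong (2 ^_) (+-suc x′ j) ⟨
    2 ^ (x′ + suc j)           ∎
    where
    x′ = 2 + (m + m)
    e : ∀ y p → (2 + y + y) * p ≡ 2 * (suc y * p)
    e = solve-∀

-- Bernoulli's inequality

-- 1 - a/X ≤ (1 - 1/X)^a, cleared of denominators (X = 1 + Y, t = X - a).
[1+Y]^a*t≤[1+Y]*Y^a : ∀ a t Y → a + t ≡ suc Y → suc Y ^ a * t ≤ suc Y * Y ^ a
[1+Y]^a*t≤[1+Y]*Y^a zero    t Y eq = ≤-reflexive (trans (+-identityʳ t) (trans eq (sym (*-identityʳ (suc Y)))))
[1+Y]^a*t≤[1+Y]*Y^a (suc a) t Y eq = begin
  suc Y ^ suc a * t         ≡⟨ e₁ (suc Y) (suc Y ^ a) t ⟩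
  suc Y ^ a * (suc Y * t)   ≤⟨ *-monoʳ-≤ (suc Y ^ a) [1+Y]t≤Y[1+t] ⟩
  suc Y ^ a * (Y * suc t)   ≡⟨ e₂ (suc Y ^ a) Y (suc t) ⟩
  Y * (suc Y ^ a * suc t)   ≤⟨ *-monoʳ-≤ Y ([1+Y]^a*t≤[1+Y]*Y^a a (suc t) Y (trans (+-suc a t) eq)) ⟩
  Y * (suc Y * Y ^ a)       ≡⟨ e₂ Y (suc Y) (Y ^ a) ⟩
  suc Y * Y ^ suc a         ∎
  where
  open ≤-Reasoning
  e₁ : ∀ x p t → x * p * t ≡ p * (x * t)
  e₁ = solve-∀
  e₂ : ∀ p y t → p * (y * t) ≡ y * (p * t)
  e₂ = solve-∀
  t≤Y : t ≤ Y
  t≤Y = ≤-pred (subst (suc t ≤_) eq (s≤s (m≤n+m t a)))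
  [1+Y]t≤Y[1+t] : suc Y * t ≤ Y * suc t
  [1+Y]t≤Y[1+t] = begin
    suc Y * t  ≡⟨ +-comm t (Y * t) ⟩
    Y * t + t  ≤⟨ +-monoʳ-≤ (Y * t) t≤Y ⟩
    Y * t + Y  ≡⟨ +-comm (Y * t) Y ⟩
    Y + Y * t  ≡⟨ *-suc Y t ⟨
    Y * suc t  ∎

-- 1 + n/X ≤ (1 + 1/X)^n, cleared of denominators.
X^n*[X+n]≤X*[1+X]^n : ∀ X n → X ^ n * (X + n) ≤ X * suc X ^ n
X^n*[X+n]≤X*[1+X]^n X zero    = ≤-reflexive (trans (+-identityʳ (X + 0)) (trans (+-identityʳ X) (sym (*-identityʳ X))))
X^n*[X+n]≤X*[1+X]^n X (suc n) = begin
  X ^ suc n * (X + suc n)             ≡⟨ e₁ X (X ^ n) n ⟩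
  X ^ n * (X * X + n * X + X)         ≤⟨ *-monoʳ-≤ (X ^ n) (m≤m+n (X * X + n * X + X) n) ⟩
  X ^ n * (X * X + n * X + X + n)     ≡⟨ e₂ X (X ^ n) n ⟩
  X ^ n * (X + n) * suc X             ≤⟨ *-monoˡ-≤ (suc X) (X^n*[X+n]≤X*[1+X]^n X n) ⟩
  X * suc X ^ n * suc X               ≡⟨ e₃ X (suc X ^ n) ⟩
  X * suc X ^ suc n                   ∎
  where
  open ≤-Reasoning
  e₁ : ∀ X p n → X * p * (X + suc n) ≡ p * (X * X + n * X + X)
  e₁ = solve-∀
  e₂ : ∀ X p n → p * (X * X + n * X + X + n) ≡ p * (X + n) * suc X
  e₂ = solve-∀
  e₃ : ∀ X p → X * p * suc X ≡ X * (suc X * p)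
  e₃ = solve-∀

-- (1 - 1/X)^n ≤ M/(1 + M) for X = n M = 1 + Y: Bernoulli applied to (1 + 1/X)^n.
Y^n*[1+M]≤[1+Y]^n*M : ∀ n M Y .{{_ : NonZero n}} → n * M ≡ suc Y → Y ^ n * suc M ≤ suc Y ^ n * M
Y^n*[1+M]≤[1+Y]^n*M n M Y nM≡X = *-cancelˡ-≤ (X ^ n * n) {{m*n≢0 (X ^ n) n {{m^n≢0 X n}}}} (begin
  X ^ n * n * (Y ^ n * suc M)   ≡⟨ e₁ (X ^ n) n (Y ^ n) M ⟩
  Y ^ n * (X ^ n * (n * M + n)) ≡⟨ cong (λ z → Y ^ n * (X ^ n * (z + n))) nM≡X ⟩
  Y ^ n * (X ^ n * (X + n))     ≤⟨ *-monoʳ-≤ (Y ^ n) (X^n*[X+n]≤X*[1+X]^n X n) ⟩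
  Y ^ n * (X * suc X ^ n)       ≡⟨ e₂ (Y ^ n) X (suc X ^ n) ⟩
  X * (Y ^ n * suc X ^ n)       ≡⟨ cong (X *_) (^-distribʳ-* Y (suc X) n) ⟨
  X * (Y * suc X) ^ n           ≤⟨ *-monoʳ-≤ X (^-monoˡ-≤ n Y[1+X]≤X*X) ⟩
  X * (X * X) ^ n               ≡⟨ cong₂ _*_ (sym nM≡X) (^-distribʳ-* X X n) ⟩
  n * M * (X ^ n * X ^ n)       ≡⟨ e₃ n M (X ^ n) ⟩
  X ^ n * n * (X ^ n * M)       ∎)
  where
  open ≤-Reasoning
  X = suc Y
  Y[1+X]≤X*X : Y * suc X ≤ X * X
  Y[1+X]≤X*X = subst (Y * suc X ≤_) (e₄ Y) (m≤m+n (Y * suc X) 1)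
    where e₄ : ∀ Y → Y * suc (suc Y) + 1 ≡ suc Y * suc Y
          e₄ = solve-∀
  e₁ : ∀ a n b m → a * n * (b * suc m) ≡ b * (a * (n * m + n))
  e₁ = solve-∀
  e₂ : ∀ a x b → a * (x * b) ≡ x * (a * b)
  e₂ = solve-∀
  e₃ : ∀ n m a → n * m * (a * a) ≡ a * n * (a * m)
  e₃ = solve-∀

-- (1 - a/(nM))^n ≤ (M/(1 + M))^a: the contribution of one block to the lower-tail estimate.
[nM∸a]^n*[1+M]^a≤[nM]^n*M^a : ∀ n M Y a t .{{_ : NonZero n}} → n * M ≡ suc Y → a + t ≡ suc Y →
                              t ^ n * suc M ^ a ≤ suc Y ^ n * M ^ a
[nM∸a]^n*[1+M]^a≤[nM]^n*M^a n M Y a t nM≡X a+t≡X =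
  *-cancelˡ-≤ (X ^ (a * n)) {{m^n≢0 X (a * n)}} (begin
  X ^ (a * n) * (t ^ n * suc M ^ a)       ≡⟨ e₁ (X ^ (a * n)) (t ^ n) (suc M ^ a) ⟩
  X ^ (a * n) * t ^ n * suc M ^ a         ≡⟨ cong (λ z → z * t ^ n * suc M ^ a) (^-*-assoc X a n) ⟨
  (X ^ a) ^ n * t ^ n * suc M ^ a         ≡⟨ cong (_* suc M ^ a) (^-distribʳ-* (X ^ a) t n) ⟨
  (X ^ a * t) ^ n * suc M ^ a             ≤⟨ *-monoˡ-≤ (suc M ^ a) (^-monoˡ-≤ n ([1+Y]^a*t≤[1+Y]*Y^a a t Y a+t≡X)) ⟩
  (X * Y ^ a) ^ n * suc M ^ a             ≡⟨ cong (_* suc M ^ a) (^-distribʳ-* X (Y ^ a) n) ⟩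
  X ^ n * (Y ^ a) ^ n * suc M ^ a         ≡⟨ e₂ (X ^ n) ((Y ^ a) ^ n) (suc M ^ a) ⟩
  X ^ n * ((Y ^ a) ^ n * suc M ^ a)       ≡⟨ cong (λ z → X ^ n * (z * suc M ^ a)) (^-*-assoc Y a n) ⟩
  X ^ n * (Y ^ (a * n) * suc M ^ a)       ≡⟨ cong (λ z → X ^ n * (z * suc M ^ a)) (trans (cong (Y ^_) (*-comm a n)) (sym (^-*-assoc Y n a))) ⟩
  X ^ n * ((Y ^ n) ^ a * suc M ^ a)       ≡⟨ cong (X ^ n *_) (^-distribʳ-* (Y ^ n) (suc M) a) ⟨
  X ^ n * (Y ^ n * suc M) ^ a             ≤⟨ *-monoʳ-≤ (X ^ n) (^-monoˡ-≤ a (Y^n*[1+M]≤[1+Y]^n*M n M Y nM≡X)) ⟩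
  X ^ n * (X ^ n * M) ^ a                 ≡⟨ cong (X ^ n *_) (^-distribʳ-* (X ^ n) M a) ⟩
  X ^ n * ((X ^ n) ^ a * M ^ a)           ≡⟨ cong (λ z → X ^ n * (z * M ^ a)) (trans (^-*-assoc X n a) (cong (X ^_) (*-comm n a))) ⟩
  X ^ n * (X ^ (a * n) * M ^ a)           ≡⟨ e₃ (X ^ n) (X ^ (a * n)) (M ^ a) ⟩
  X ^ (a * n) * (X ^ n * M ^ a)           ∎)
  where
  open ≤-Reasoning
  X = suc Y
  e₁ : ∀ a b c → a * (b * c) ≡ a * b * c
  e₁ = solve-∀
  e₂ : ∀ a b c → a * b * c ≡ a * (b * c)
  e₂ = solve-∀
  e₃ : ∀ a b c → a * (b * c) ≡ b * (a * c)
  e₃ = solve-∀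

-- The exponential series

m^k*m!≤[m+k]! : ∀ m k → m ^ k * m ! ≤ (m + k) !
m^k*m!≤[m+k]! m zero    = ≤-reflexive (trans (+-identityʳ (m !)) (cong _! (sym (+-identityʳ m))))
m^k*m!≤[m+k]! m (suc k) = begin
  m * m ^ k * m !          ≡⟨ *-assoc m (m ^ k) (m !) ⟩
  m * (m ^ k * m !)        ≤⟨ *-mono-≤ (≤-trans (m≤m+n m k) (n≤1+n (m + k))) (m^k*m!≤[m+k]! m k) ⟩
  suc (m + k) * (m + k) !  ≡⟨ cong _! (+-suc m k) ⟨
  (m + suc k) !            ∎
  where open ≤-Reasoning

[m+k]!≤2^[m+k]*[m!*k!] : ∀ m k → (m + k) ! ≤ 2 ^ (m + k) * (m ! * k !)
[m+k]!≤2^[m+k]*[m!*k!] zero    k       =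
  subst (λ y → k ! ≤ 2 ^ k * y) (sym (*-identityˡ (k !))) (m≤n*m (k !) (2 ^ k) {{m^n≢0 2 k}})
[m+k]!≤2^[m+k]*[m!*k!] (suc m) zero    = subst (λ x → x ! ≤ 2 ^ x * (suc m ! * 1)) (sym (+-identityʳ (suc m)))
  (subst (λ y → suc m ! ≤ 2 ^ suc m * y) (sym (*-identityʳ (suc m !))) (m≤n*m (suc m !) (2 ^ suc m) {{m^n≢0 2 (suc m)}}))
[m+k]!≤2^[m+k]*[m!*k!] (suc m) (suc k) = begin
  (suc m + suc k) * N !                                        ≡⟨ *-distribʳ-+ (N !) (suc m) (suc k) ⟩
  suc m * N ! + suc k * N !                                    ≤⟨ +-mono-≤ (*-monoʳ-≤ (suc m) left) (*-monoʳ-≤ (suc k) right) ⟩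
  suc m * (2 ^ N * (m ! * suc k !)) + suc k * (2 ^ N * (suc m ! * k !)) ≡⟨ e (suc m) (suc k) (2 ^ N) (m !) (k !) ⟩
  2 ^ suc N * (suc m ! * suc k !)                              ∎
  where
  open ≤-Reasoning
  N = m + suc k
  left : N ! ≤ 2 ^ N * (m ! * suc k !)
  left = [m+k]!≤2^[m+k]*[m!*k!] m (suc k)
  right : N ! ≤ 2 ^ N * (suc m ! * k !)
  right = subst (λ x → x ! ≤ 2 ^ x * (suc m ! * k !)) (sym (+-suc m k)) ([m+k]!≤2^[m+k]*[m!*k!] (suc m) k)
  e : ∀ a b p x y → a * (p * (x * (b * y))) + b * (p * (a * x * y)) ≡ 2 * p * (a * x * (b * y))
  e = solve-∀

m^k≤2^[m+k]*k! : ∀ m k → m ^ k ≤ 2 ^ (m + k) * k !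
m^k≤2^[m+k]*k! m k = *-cancelʳ-≤ (m ^ k) (2 ^ (m + k) * k !) (m !) {{m !≢0}} (begin
  m ^ k * m !                  ≤⟨ m^k*m!≤[m+k]! m k ⟩
  (m + k) !                    ≤⟨ [m+k]!≤2^[m+k]*[m!*k!] m k ⟩
  2 ^ (m + k) * (m ! * k !)    ≡⟨ e (2 ^ (m + k)) (m !) (k !) ⟩
  2 ^ (m + k) * k ! * m !      ∎)
  where
  open ≤-Reasoning
  e : ∀ p x y → p * (x * y) ≡ p * y * x
  e = solve-∀

d^k*2^k≤2^[4d]*k! : ∀ d k → d ^ k * 2 ^ k ≤ 2 ^ (4 * d) * k !
d^k*2^k≤2^[4d]*k! d k = *-cancelʳ-≤ (d ^ k * 2 ^ k) (2 ^ (4 * d) * k !) (2 ^ k) {{m^n≢0 2 k}} (begin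
  d ^ k * 2 ^ k * 2 ^ k          ≡⟨ *-assoc (d ^ k) (2 ^ k) (2 ^ k) ⟩
  d ^ k * (2 ^ k * 2 ^ k)        ≡⟨ cong (d ^ k *_) (^-distribʳ-* 2 2 k) ⟨
  d ^ k * 4 ^ k                  ≡⟨ ^-distribʳ-* d 4 k ⟨
  (d * 4) ^ k                    ≡⟨ cong (_^ k) (*-comm d 4) ⟩
  (4 * d) ^ k                    ≤⟨ m^k≤2^[m+k]*k! (4 * d) k ⟩
  2 ^ (4 * d + k) * k !          ≡⟨ cong (_* k !) (^-distribˡ-+-* 2 (4 * d) k) ⟩
  2 ^ (4 * d) * 2 ^ k * k !      ≡⟨ e (2 ^ (4 * d)) (2 ^ k) (k !) ⟩
  2 ^ (4 * d) * k ! * 2 ^ k      ∎)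
  where
  open ≤-Reasoning
  e : ∀ a p f → a * p * f ≡ a * f * p
  e = solve-∀

-- Σ_{k ≤ K} d^k/k! ≤ 2^(4d) (2 - 2^-K), multiplied through by K! 2^K.
expScaled-bound : ∀ d K → expScaled d K * 2 ^ K + K ! * 2 ^ (4 * d) ≤ K ! * 2 ^ (4 * d) * 2 ^ suc K
expScaled-bound d zero = ≤-trans (+-monoˡ-≤ (1 * A) (m^n>0 2 (4 * d))) (≤-reflexive (e A))
  where
  A = 2 ^ (4 * d)
  e : ∀ a → a + 1 * a ≡ 1 * a * 2
  e = solve-∀
expScaled-bound d (suc K) = begin
  (suc K * E + d ^ suc K) * (2 * 2 ^ K) + suc K * K ! * A        ≡⟨ e₁ (suc K) E (d ^ suc K) (2 ^ K) (suc K * K ! * A) ⟩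
  2 * suc K * (E * 2 ^ K) + d ^ suc K * 2 ^ suc K + suc K * K ! * A
    ≤⟨ +-monoˡ-≤ (suc K * K ! * A) (+-monoʳ-≤ (2 * suc K * (E * 2 ^ K)) (d^k*2^k≤2^[4d]*k! d (suc K))) ⟩
  2 * suc K * (E * 2 ^ K) + A * (suc K * K !) + suc K * K ! * A  ≡⟨ e₂ (suc K) (E * 2 ^ K) (K !) A ⟩
  2 * suc K * (E * 2 ^ K + K ! * A)                              ≤⟨ *-monoʳ-≤ (2 * suc K) (expScaled-bound d K) ⟩
  2 * suc K * (K ! * A * 2 ^ suc K)                              ≡⟨ e₃ (suc K) (K !) A (2 ^ suc K) ⟩
  suc K * K ! * A * 2 ^ suc (suc K)                              ∎
  where
  open ≤-Reasoning
  A = 2 ^ (4 * d)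
  E = expScaled d K
  e₁ : ∀ k E q p r → (k * E + q) * (2 * p) + r ≡ 2 * k * (E * p) + q * (2 * p) + r
  e₁ = solve-∀
  e₂ : ∀ k x f a → 2 * k * x + a * (k * f) + k * f * a ≡ 2 * k * (x + f * a)
  e₂ = solve-∀
  e₃ : ∀ k f a p → 2 * k * (f * a * p) ≡ k * f * a * (2 * p)
  e₃ = solve-∀

LogLe⇒n≤2^[1+4d] : ∀ {n d} → LogLe n d → n ≤ 2 ^ suc (4 * d)
LogLe⇒n≤2^[1+4d] {n} {d} (K , nK!≤E) = *-cancelʳ-≤ n (2 ^ suc (4 * d)) (K ! * 2 ^ K) {{m*n≢0 (K !) (2 ^ K) {{K !≢0}} {{m^n≢0 2 K}}}} (begin
  n * (K ! * 2 ^ K)                               ≡⟨ *-assoc n (K !) (2 ^ K) ⟨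
  n * K ! * 2 ^ K                                 ≤⟨ *-monoˡ-≤ (2 ^ K) nK!≤E ⟩
  expScaled d K * 2 ^ K                           ≤⟨ m≤m+n (expScaled d K * 2 ^ K) (K ! * A) ⟩
  expScaled d K * 2 ^ K + K ! * A                 ≤⟨ expScaled-bound d K ⟩
  K ! * A * 2 ^ suc K                             ≡⟨ e (K !) A (2 ^ K) ⟩
  2 * A * (K ! * 2 ^ K)                           ∎)
  where
  open ≤-Reasoning
  A = 2 ^ (4 * d)
  e : ∀ f a p → f * a * (2 * p) ≡ 2 * a * (f * p)
  e = solve-∀

expScaled-zero : ∀ K → expScaled 0 K ≡ K !
expScaled-zero zero    = refl
expScaled-zero (suc K) = trans (+-identityʳ _) (cong (suc K *_) (expScaled-zero K))

LogLe⇒d≢0 : ∀ {n d} → 2 ≤ n → LogLe n d → NonZero d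
LogLe⇒d≢0 {d = suc _} _    _            = _
LogLe⇒d≢0 {n} {zero}  2≤n (K , nK!≤E) = ⊥-elim (<⇒≱ 2≤n (*-cancelʳ-≤ n 1 (K !) {{K !≢0}} (begin
  n * K !        ≤⟨ nK!≤E ⟩
  expScaled 0 K  ≡⟨ expScaled-zero K ⟩
  K !            ≡⟨ *-identityˡ (K !) ⟨
  1 * K !        ∎)))
  where open ≤-Reasoning

sum-mono-≤ : ∀ {n} {f g : Fin n → ℕ} → (∀ i → f i ≤ g i) → sum f ≤ sum g
sum-mono-≤ {zero}  f≤g = z≤n
sum-mono-≤ {suc n} f≤g = +-mono-≤ (f≤g zero) (sum-mono-≤ (λ i → f≤g (suc i)))

sum-const : ∀ n x → ∑[ i < n ] x ≡ n * x
sum-const zero    x = refl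
sum-const (suc n) x = cong (x +_) (sum-const n x)

sum-≤-const : ∀ {n} b {f : Fin n → ℕ} → (∀ i → f i ≤ b) → sum f ≤ n * b
sum-≤-const {n} b f≤b = subst (_ ≤_) (sum-const n b) (sum-mono-≤ f≤b)

f≤sum : ∀ {n} (f : Fin n → ℕ) i → f i ≤ sum f
f≤sum f zero    = m≤m+n (f zero) _
f≤sum f (suc i) = ≤-trans (f≤sum (λ j → f (suc j)) i) (m≤n+m _ (f zero))

sum-<-average : ∀ {n} .{{_ : NonZero n}} (f : Fin n → ℕ) {Y} → (∀ i → f i * n < Y) → sum f < Y
sum-<-average {suc n} f {Y} f*n<Y = *-cancelʳ-< (suc n) (sum f) Y (begin-strict
  sum f * suc n                   ≡⟨ *-distribʳ-sum (suc n) f ⟩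
  ∑[ i < suc n ] (f i * suc n)    <⟨ +-monoˡ-< _ (f*n<Y zero) ⟩
  Y + ∑[ i < n ] (f (suc i) * suc n) ≤⟨ +-monoʳ-≤ Y (sum-≤-const Y (λ i → <⇒≤ (f*n<Y (suc i)))) ⟩
  Y + n * Y                       ≡⟨ *-comm (suc n) Y ⟩
  Y * suc n                       ∎)
  where open ≤-Reasoning

sum-<-∃ : ∀ {n} (f g : Fin n → ℕ) → sum f < sum g → ∃ λ i → f i < g i
sum-<-∃ {suc n} f g Σf<Σg with f zero <? g zero
... | yes f₀<g₀ = zero , f₀<g₀
... | no  f₀≮g₀ with sum-<-∃ (λ i → f (suc i)) (λ i → g (suc i))
                       (+-cancelˡ-< (g zero) _ _ (≤-<-trans (+-monoˡ-≤ _ (≮⇒≥ f₀≮g₀)) Σf<Σg))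
...   | i , fᵢ<gᵢ = suc i , fᵢ<gᵢ

𝟙 : Bool → ℕ
𝟙 true  = 1
𝟙 false = 0

*𝟙-≤ : ∀ {P : Set} (P? : Dec P) {x y} → (P → x ≤ y) → x * 𝟙 (does P?) ≤ y
*𝟙-≤ (yes p) {x} {y} x≤y = subst (_≤ y) (sym (*-identityʳ x)) (x≤y p)
*𝟙-≤ (no  _) {x} {y} x≤y = subst (_≤ y) (sym (*-zeroʳ x)) z≤n

sum-≟∧ : ∀ {m} i (b : Fin m → Bool) → ∑[ k < m ] 𝟙 (does (k ≟ i) ∧ b k) ≡ 𝟙 (b i)
sum-≟∧ {suc m} zero    b = trans (cong (𝟙 (b zero) +_) (trans (sum-const m 0) (*-zeroʳ m))) (+-identityʳ (𝟙 (b zero)))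
sum-≟∧ {suc m} (suc i) b = sum-≟∧ i (λ k → b (suc k))

count-tabulate : ∀ {m} (f : Fin m → Bool) → ∣ tabulate f ∣ ≡ ∑[ i < m ] 𝟙 (f i)
count-tabulate {zero}  f = refl
count-tabulate {suc m} f with f zero
... | true  = cong suc (count-tabulate (λ i → f (suc i)))
... | false = count-tabulate (λ i → f (suc i))

sum-↑ : ∀ a b (h : Fin (a + b) → ℕ) → sum h ≡ ∑[ i < a ] h (i ↑ˡ b) + ∑[ j < b ] h (a ↑ʳ j)
sum-↑ zero    b h = refl
sum-↑ (suc a) b h = trans (cong (h zero +_) (sum-↑ a b (λ i → h (suc i)))) (sym (+-assoc (h zero) _ _))

sum-combine : ∀ K n (h : Fin (K * n) → ℕ) → sum h ≡ ∑[ g < K ] ∑[ k < n ] h (combine g k)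
sum-combine zero    n h = refl
sum-combine (suc K) n h = trans (sum-↑ n (K * n) h) (cong (∑[ k < n ] h (k ↑ˡ K * n) +_) (sum-combine K n (λ v → h (n ↑ʳ v))))

prod-mono-≤ : ∀ {n} {f g : Fin n → ℕ} → (∀ i → f i ≤ g i) → prod f ≤ prod g
prod-mono-≤ {zero}  f≤g = ≤-refl
prod-mono-≤ {suc n} f≤g = *-mono-≤ (f≤g zero) (prod-mono-≤ (λ i → f≤g (suc i)))

prod-const : ∀ n x → prod {n} (λ _ → x) ≡ x ^ n
prod-const zero    x = refl
prod-const (suc n) x = cong (x *_) (prod-const n x)

prod-^ : ∀ {n} x (f : Fin n → ℕ) → prod (λ i → x ^ f i) ≡ x ^ sum f
prod-^ {zero}  x f = refl
prod-^ {suc n} x f = trans (cong (x ^ f zero *_) (prod-^ x (λ i → f (suc i)))) (sym (^-distribˡ-+-* x (f zero) _))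

prod-^ʳ : ∀ {n} (f : Fin n → ℕ) m → prod f ^ m ≡ prod (λ i → f i ^ m)
prod-^ʳ {zero}  f m = ^-zeroˡ m
prod-^ʳ {suc n} f m = trans (^-distribʳ-* (f zero) _ m) (cong (f zero ^ m *_) (prod-^ʳ (λ i → f (suc i)) m))

sumFun : ∀ K {n} → ((Fin K → Fin n) → ℕ) → ℕ
sumFun zero    F = F (λ ())
sumFun (suc K) F = ∑[ x < _ ] sumFun K (λ s → F (x ∷ s))

sumFun-mono-≤ : ∀ K {n} {F G : (Fin K → Fin n) → ℕ} → (∀ s → F s ≤ G s) → sumFun K F ≤ sumFun K G
sumFun-mono-≤ zero    F≤G = F≤G _
sumFun-mono-≤ (suc K) F≤G = sum-mono-≤ (λ x → sumFun-mono-≤ K (λ s → F≤G (x ∷ s)))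

sumFun-*ˡ : ∀ K {n} a (F : (Fin K → Fin n) → ℕ) → sumFun K (λ s → a * F s) ≡ a * sumFun K F
sumFun-*ˡ zero    a F = refl
sumFun-*ˡ (suc K) a F = trans (sum-cong-≗ (λ x → sumFun-*ˡ K a (λ s → F (x ∷ s)))) (sym (*-distribˡ-sum a (λ x → sumFun K (λ s → F (x ∷ s)))))

sumFun-sum : ∀ K {n m} (F : Fin m → (Fin K → Fin n) → ℕ) →
             sumFun K (λ s → ∑[ i < m ] F i s) ≡ ∑[ i < m ] sumFun K (F i)
sumFun-sum zero    F = refl
sumFun-sum (suc K) {n} F = trans (sum-cong-≗ {n} (λ x → sumFun-sum K (λ i s → F i (x ∷ s))))
                             (∑-comm (λ x i → sumFun K (λ s → F i (x ∷ s))))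

sumFun-one : ∀ K n → sumFun K {n} (λ _ → 1) ≡ n ^ K
sumFun-one zero    n = refl
sumFun-one (suc K) n = trans (sum-cong-≗ {n} (λ _ → sumFun-one K n)) (sum-const n (n ^ K))

sumFun-prod : ∀ K {n} (h : Fin K → Fin n → ℕ) →
              sumFun K (λ s → prod (λ g → h g (s g))) ≡ prod (λ g → sum (h g))
sumFun-prod zero    h = refl
sumFun-prod (suc K) h = begin
  ∑[ x < _ ] sumFun K (λ s → h zero x * prod (λ g → h (suc g) (s g)))  ≡⟨ sum-cong-≗ (λ x → sumFun-*ˡ K (h zero x) _) ⟩
  ∑[ x < _ ] (h zero x * sumFun K (λ s → prod (λ g → h (suc g) (s g)))) ≡⟨ sum-cong-≗ (λ x → cong (h zero x *_) (sumFun-prod K (λ g → h (suc g)))) ⟩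
  ∑[ x < _ ] (h zero x * prod (λ g → sum (h (suc g))))                  ≡⟨ *-distribʳ-sum _ (h zero) ⟨
  sum (h zero) * prod (λ g → sum (h (suc g)))                           ∎
  where open ≡-Reasoning

sumFun-<-∃ : ∀ K {n} (F G : (Fin K → Fin n) → ℕ) → sumFun K F < sumFun K G → ∃ λ s → F s < G s
sumFun-<-∃ zero    F G ΣF<ΣG = _ , ΣF<ΣG
sumFun-<-∃ (suc K) F G ΣF<ΣG with sum-<-∃ _ _ ΣF<ΣG
... | x , lt with sumFun-<-∃ K _ _ lt
...   | s , Fs<Gs = x ∷ s , Fs<Gs

-- Chernoff's lower-tail bound

-- With M = 2c, the weight M′/M = 1 - 1/(2c) makes a part short by K/c neighbours with
-- probability at most (P/Q)^(K/c), and (Q/P)^Λ ≥ 2^c.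
module Constants (k : ℕ) where

  c M′ M R S P Q Λ C₀ : ℕ
  c  = suc k
  M′ = suc (k + k)
  M  = suc M′
  R  = M′ * suc M
  S  = M * M
  P  = S ^ c * M
  Q  = R ^ c * suc M
  Λ  = P * c
  C₀ = Λ * (Λ + Λ + 22)

  S≡1+R : S ≡ suc R
  S≡1+R = e k
    where
    e : ∀ k → suc (suc (k + k)) * suc (suc (k + k)) ≡ suc (suc (k + k) * suc (suc (suc (k + k))))
    e = solve-∀

  instance
    S≢0 : NonZero S
    S≢0 = subst NonZero (sym S≡1+R) _
    P≢0 : NonZero P
    P≢0 = m*n≢0 (S ^ c) M {{m^n≢0 S c}}
    Λ≢0 : NonZero Λ
    Λ≢0 = m*n≢0 P c

  P<Q : P < Q
  P<Q = *-cancelˡ-< S P Q (begin-strict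
    S * (S ^ c * M)        ≡⟨ e₁ S (S ^ c) M ⟩
    S ^ c * (S * M)        ≡⟨ cong (λ z → S ^ c * (z * M)) c+t≡S ⟨
    S ^ c * ((c + t) * M)  <⟨ *-monoʳ-< (S ^ c) {{m^n≢0 S c}} [c+t]M<t[1+M] ⟩
    S ^ c * (t * suc M)    ≡⟨ *-assoc (S ^ c) t (suc M) ⟨
    S ^ c * t * suc M      ≤⟨ *-monoˡ-≤ (suc M) (subst (λ s → s ^ c * t ≤ s * R ^ c) (sym S≡1+R)
                                ([1+Y]^a*t≤[1+Y]*Y^a c t R (trans c+t≡S S≡1+R))) ⟩
    S * R ^ c * suc M      ≡⟨ *-assoc S (R ^ c) (suc M) ⟩
    S * (R ^ c * suc M)    ∎)
    where
    open ≤-Reasoning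
    t = c * M′ + c * M
    c+t≡S : c + t ≡ S
    c+t≡S = e k
      where
      e : ∀ k → suc k + (suc k * suc (k + k) + suc k * suc (suc (k + k))) ≡ suc (suc (k + k)) * suc (suc (k + k))
      e = solve-∀
    [c+t]M<t[1+M] : (c + t) * M < t * suc M
    [c+t]M<t[1+M] = begin-strict
      (c + t) * M      ≡⟨ *-distribʳ-+ M c t ⟩
      c * M + t * M    <⟨ +-monoˡ-< (t * M) (m<n+m (c * M) z<s) ⟩
      t + t * M        ≡⟨ *-suc t M ⟨
      t * suc M        ∎
    e₁ : ∀ s p m → s * (p * m) ≡ p * (s * m)
    e₁ = solve-∀

  2*P^P≤Q^P : 2 * P ^ P ≤ Q ^ P
  2*P^P≤Q^P = *-cancelˡ-≤ P (begin
    P * (2 * P ^ P)   ≡⟨ e P (P ^ P) ⟩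
    P ^ P * (P + P)   ≤⟨ X^n*[X+n]≤X*[1+X]^n P P ⟩
    P * suc P ^ P     ≤⟨ *-monoʳ-≤ P (^-monoˡ-≤ P P<Q) ⟩
    P * Q ^ P         ∎)
    where
    open ≤-Reasoning
    e : ∀ p x → p * (2 * x) ≡ x * (p + p)
    e = solve-∀

  [2^q]^c*P^K≤Q^K : ∀ q r → (2 ^ q) ^ c * P ^ (r + q * Λ) ≤ Q ^ (r + q * Λ)
  [2^q]^c*P^K≤Q^K q r = begin
    (2 ^ q) ^ c * P ^ (r + q * Λ)             ≡⟨ cong₂ _*_ (^-*-assoc 2 q c) (^-distribˡ-+-* P r (q * Λ)) ⟩
    2 ^ (q * c) * (P ^ r * P ^ (q * Λ))       ≡⟨ cong (λ z → 2 ^ (q * c) * (P ^ r * z)) P^qΛ ⟩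
    2 ^ (q * c) * (P ^ r * (P ^ P) ^ (q * c)) ≡⟨ e (2 ^ (q * c)) (P ^ r) ((P ^ P) ^ (q * c)) ⟩
    P ^ r * (2 ^ (q * c) * (P ^ P) ^ (q * c)) ≡⟨ cong (P ^ r *_) (^-distribʳ-* 2 (P ^ P) (q * c)) ⟨
    P ^ r * (2 * P ^ P) ^ (q * c)             ≤⟨ *-mono-≤ (^-monoˡ-≤ r (<⇒≤ P<Q)) (^-monoˡ-≤ (q * c) 2*P^P≤Q^P) ⟩
    Q ^ r * (Q ^ P) ^ (q * c)                 ≡⟨ cong (Q ^ r *_) Q^qΛ ⟨
    Q ^ r * Q ^ (q * Λ)                       ≡⟨ ^-distribˡ-+-* Q r (q * Λ) ⟨
    Q ^ (r + q * Λ)                           ∎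
    where
    open ≤-Reasoning
    qΛ≡P[qc] : q * Λ ≡ P * (q * c)
    qΛ≡P[qc] = e′ q P c
      where
      e′ : ∀ q p c → q * (p * c) ≡ p * (q * c)
      e′ = solve-∀
    P^qΛ : P ^ (q * Λ) ≡ (P ^ P) ^ (q * c)
    P^qΛ = trans (cong (P ^_) qΛ≡P[qc]) (sym (^-*-assoc P P (q * c)))
    Q^qΛ : Q ^ (q * Λ) ≡ (Q ^ P) ^ (q * c)
    Q^qΛ = trans (cong (Q ^_) qΛ≡P[qc]) (sym (^-*-assoc Q P (q * c)))
    e : ∀ a b x → a * (b * x) ≡ b * (a * x)
    e = solve-∀

  Kn²<2^[K/Λ] : ∀ {n d K} .{{_ : NonZero d}} → n ≤ 2 ^ suc (4 * d) → C₀ * d ≤ K → K * n * n < 2 ^ (K / Λ)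
  Kn²<2^[K/Λ] {n} {d@(suc d′)} {K} n≤2^e C₀d≤K = begin-strict
    K * n * n                      ≡⟨ *-assoc K n n ⟩
    K * (n * n)                    ≤⟨ *-monoʳ-≤ K n*n≤2^[e+e] ⟩
    K * 2 ^ (e + e)                <⟨ *-monoˡ-< (2 ^ (e + e)) {{m^n≢0 2 (e + e)}} (<-≤-trans K<Λ[1+q] (*-monoˡ-≤ (suc q) (<⇒≤ (n<2^n Λ)))) ⟩
    2 ^ Λ * suc q * 2 ^ (e + e)    ≡⟨ e₁ (2 ^ Λ) (suc q) (2 ^ (e + e)) ⟩
    suc q * (2 ^ Λ * 2 ^ (e + e))  ≡⟨ cong (suc q *_) (^-distribˡ-+-* 2 Λ (e + e)) ⟨
    suc q * 2 ^ m                  ≤⟨ [1+x]*2^m≤2^x m q 2+2m≤q ⟩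
    2 ^ q                          ∎
    where
    open ≤-Reasoning
    q = K / Λ
    e = suc (4 * d)
    m = Λ + (e + e)
    e₁ : ∀ a b c → a * b * c ≡ b * (a * c)
    e₁ = solve-∀
    2+2m≤q : 2 + (m + m) ≤ q
    2+2m≤q = begin
      2 + (m + m)                               ≡⟨ e₂ Λ d′ ⟩
      Λ + Λ + 22 + 16 * d′                      ≤⟨ +-monoʳ-≤ (Λ + Λ + 22) (*-monoˡ-≤ d′ (m≤n+m 16 (Λ + Λ))) ⟩
      Λ + Λ + 22 + (Λ + Λ + 16) * d′            ≤⟨ +-monoʳ-≤ (Λ + Λ + 22) (*-monoˡ-≤ d′ (+-monoʳ-≤ (Λ + Λ) (m≤m+n 16 6))) ⟩
      Λ + Λ + 22 + (Λ + Λ + 22) * d′            ≡⟨ *-suc (Λ + Λ + 22) d′ ⟨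
      (Λ + Λ + 22) * d                          ≡⟨ m*n/n≡m ((Λ + Λ + 22) * d) Λ ⟨
      (Λ + Λ + 22) * d * Λ / Λ                  ≡⟨ cong (_/ Λ) (e₃ (Λ + Λ + 22) d Λ) ⟩
      C₀ * d / Λ                                ≤⟨ /-monoˡ-≤ Λ C₀d≤K ⟩
      q                                         ∎
      where
      e₂ : ∀ Λ d′ → 2 + ((Λ + (suc (4 * suc d′) + suc (4 * suc d′))) + (Λ + (suc (4 * suc d′) + suc (4 * suc d′))))
                    ≡ Λ + Λ + 22 + 16 * d′
      e₂ = solve-∀
      e₃ : ∀ a d l → a * d * l ≡ l * a * d
      e₃ = solve-∀
    K<Λ[1+q] : K < Λ * suc q
    K<Λ[1+q] = begin-strict
      K              ≡⟨ m≡m%n+[m/n]*n K Λ ⟩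
      K % Λ + q * Λ  <⟨ +-monoˡ-< (q * Λ) (m%n<n K Λ) ⟩
      Λ + q * Λ      ≡⟨ cong (Λ +_) (*-comm q Λ) ⟩
      Λ + Λ * q      ≡⟨ *-suc Λ q ⟨
      Λ * suc q      ∎
    n*n≤2^[e+e] : n * n ≤ 2 ^ (e + e)
    n*n≤2^[e+e] = begin
      n * n           ≤⟨ *-mono-≤ n≤2^e n≤2^e ⟩
      2 ^ e * 2 ^ e   ≡⟨ ^-distribˡ-+-* 2 e e ⟨
      2 ^ (e + e)     ∎

  -- (P/Q)^K beats the polynomial (K n²)^c once K ≥ C₀ d and log n = O(d).
  [Kn²]^c*P^K<Q^K : ∀ {n d K} .{{_ : NonZero d}} → n ≤ 2 ^ suc (4 * d) → C₀ * d ≤ K →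
                    (K * n * n) ^ c * P ^ K < Q ^ K
  [Kn²]^c*P^K<Q^K {n} {d} {K} n≤2^[1+4d] C₀d≤K = begin-strict
    (K * n * n) ^ c * P ^ K        <⟨ *-monoˡ-< (P ^ K) {{m^n≢0 P K}} (^-monoˡ-< c (Kn²<2^[K/Λ] n≤2^[1+4d] C₀d≤K)) ⟩
    (2 ^ q) ^ c * P ^ K            ≡⟨ cong (λ z → (2 ^ q) ^ c * P ^ z) K≡r+qΛ ⟩
    (2 ^ q) ^ c * P ^ (r + q * Λ)  ≤⟨ [2^q]^c*P^K≤Q^K q r ⟩
    Q ^ (r + q * Λ)                ≡⟨ cong (Q ^_) K≡r+qΛ ⟨
    Q ^ K                          ∎
    where
    open ≤-Reasoning
    q = K / Λ
    r = K % Λ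
    K≡r+qΛ : K ≡ r + q * Λ
    K≡r+qΛ = m≡m%n+[m/n]*n K Λ

-- The exponential-moment weight (M′/M)^hits, scaled by M^K to stay in ℕ.
weight : ℕ → Bool → ℕ
weight M′ true  = M′
weight M′ false = suc M′

prod-weight : ∀ M′ {K} (b : Fin K → Bool) →
              prod (λ g → weight M′ (b g)) * suc M′ ^ sum (λ g → 𝟙 (b g)) ≡ M′ ^ sum (λ g → 𝟙 (b g)) * suc M′ ^ K
prod-weight M′ {zero}  b = refl
prod-weight M′ {suc K} b with b zero | prod-weight M′ (λ g → b (suc g))
... | true  | ih = trans (e M′ P′ (suc M′) (suc M′ ^ σ)) (trans (cong (M′ * suc M′ *_) ih) (e M′ (suc M′) (M′ ^ σ) (suc M′ ^ K)))
  where
  P′ = prod (λ g → weight M′ (b (suc g)))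
  σ = sum (λ g → 𝟙 (b (suc g)))
  e : ∀ a b c d → a * b * (c * d) ≡ a * c * (b * d)
  e = solve-∀
... | false | ih = trans (*-assoc (suc M′) P′ (suc M′ ^ σ)) (trans (cong (suc M′ *_) ih) (e (suc M′) (M′ ^ σ) (suc M′ ^ K)))
  where
  P′ = prod (λ g → weight M′ (b (suc g)))
  σ = sum (λ g → 𝟙 (b (suc g)))
  e : ∀ a b c → a * (b * c) ≡ b * (a * c)
  e = solve-∀

hits : ∀ {K n} → (Fin K → Fin n → Bool) → (Fin K → Fin n) → ℕ
hits {K} X s = ∑[ g < K ] 𝟙 (X g (s g))

total : ∀ {K n} → (Fin K → Fin n → Bool) → ℕ
total {K} {n} X = ∑[ g < K ] ∑[ x < n ] 𝟙 (X g x)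

module LowerTail (k : ℕ) {K n′ : ℕ} (X : Fin K → Fin (suc n′) → Bool) where
  open Constants k

  n : ℕ
  n = suc n′

  degree : Fin K → ℕ
  degree g = ∑[ x < n ] 𝟙 (X g x)

  D : ℕ
  D = total X

  Bad : (Fin K → Fin n) → Set
  Bad s = c * (n * hits X s) + n * K < c * D

  Bad? : ∀ s → Dec (Bad s)
  Bad? s = c * (n * hits X s) + n * K <? c * D

  #Bad : ℕ
  #Bad = sumFun K (λ s → 𝟙 (does (Bad? s)))

  blockWeight : Fin K → ℕ
  blockWeight g = ∑[ x < n ] weight M′ (X g x)

  degree+blockWeight≡nM : ∀ g → degree g + blockWeight g ≡ n * M
  degree+blockWeight≡nM g = begin
    degree g + blockWeight g                    ≡⟨ ∑-distrib-+ (λ x → 𝟙 (X g x)) (λ x → weight M′ (X g x)) ⟨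
    ∑[ x < n ] (𝟙 (X g x) + weight M′ (X g x))   ≡⟨ sum-cong-≗ (λ x → 𝟙+weight (X g x)) ⟩
    ∑[ x < n ] M                                ≡⟨ sum-const n M ⟩
    n * M                                       ∎
    where
    open ≡-Reasoning
    𝟙+weight : ∀ b → 𝟙 b + weight M′ b ≡ M
    𝟙+weight true  = refl
    𝟙+weight false = refl

  D≤K*n : D ≤ K * n
  D≤K*n = sum-≤-const n (λ g → subst (degree g ≤_) (*-identityʳ n) (sum-≤-const 1 (λ x → 𝟙≤1 (X g x))))
    where
    𝟙≤1 : ∀ b → 𝟙 b ≤ 1
    𝟙≤1 true  = ≤-refl
    𝟙≤1 false = z≤n

  -- The largest T with c n T + n K < c D (when there is one).
  T : ℕ
  T = (c * D ∸ suc (n * K)) / (c * n)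

  Bad⇒hits≤T : ∀ {s} → Bad s → hits X s ≤ T
  Bad⇒hits≤T {s} bad = begin
    hits X s                        ≡⟨ m*n/n≡m (hits X s) (c * n) ⟨
    hits X s * (c * n) / (c * n)    ≤⟨ /-monoˡ-≤ (c * n) (m+n≤o⇒m≤o∸n (hits X s * (c * n)) (≤-trans (≤-reflexive (e (hits X s) c n (n * K))) bad)) ⟩
    T                             ∎
    where
    open ≤-Reasoning
    e : ∀ z c n q → z * (c * n) + suc q ≡ suc (c * (n * z) + q)
    e = solve-∀

  cnT+nK<cD : n * K < c * D → c * (n * T) + n * K < c * D
  cnT+nK<cD nK<cD = begin
    suc (c * (n * T) + n * K)                   ≡⟨ e T c n (n * K) ⟩
    T * (c * n) + suc (n * K)                   ≤⟨ +-monoˡ-≤ (suc (n * K)) (m/n*n≤m (c * D ∸ suc (n * K)) (c * n)) ⟩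
    c * D ∸ suc (n * K) + suc (n * K)           ≡⟨ m∸n+n≡m nK<cD ⟩
    c * D                                       ∎
    where
    open ≤-Reasoning
    e : ∀ z c n q → suc (c * (n * z) + q) ≡ z * (c * n) + suc q
    e = solve-∀

  -- Markov's inequality for the weight (M′/M)^hits, which is large when s has few hits.
  exponential-markov : #Bad * (M′ ^ T * M ^ K) ≤ M ^ T * prod blockWeight
  exponential-markov = begin
    #Bad * w                                      ≡⟨ *-comm #Bad w ⟩
    w * #Bad                                      ≡⟨ sumFun-*ˡ K w (λ s → 𝟙 (does (Bad? s))) ⟨
    sumFun K (λ s → w * 𝟙 (does (Bad? s)))        ≤⟨ sumFun-mono-≤ K bad-weight ⟩
    sumFun K (λ s → M ^ T * W s)                  ≡⟨ sumFun-*ˡ K (M ^ T) W ⟩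
    M ^ T * sumFun K W                            ≡⟨ cong (M ^ T *_) (sumFun-prod K (λ g x → weight M′ (X g x))) ⟩
    M ^ T * prod blockWeight                      ∎
    where
    open ≤-Reasoning
    w = M′ ^ T * M ^ K
    W : (Fin K → Fin n) → ℕ
    W s = prod (λ g → weight M′ (X g (s g)))
    few-hits⇒heavy : ∀ s → hits X s ≤ T → w ≤ M ^ T * W s
    few-hits⇒heavy s Z≤T = *-cancelʳ-≤ w (M ^ T * W s) (M ^ Z) {{m^n≢0 M Z}} (begin
      M′ ^ T * M ^ K * M ^ Z      ≡⟨ e (M′ ^ T) (M ^ K) (M ^ Z) ⟩
      M′ ^ T * M ^ Z * M ^ K      ≤⟨ *-monoˡ-≤ (M ^ K) (x^j*y^i≤y^j*x^i (n≤1+n M′) Z≤T) ⟩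
      M ^ T * M′ ^ Z * M ^ K      ≡⟨ *-assoc (M ^ T) (M′ ^ Z) (M ^ K) ⟩
      M ^ T * (M′ ^ Z * M ^ K)    ≡⟨ cong (M ^ T *_) (prod-weight M′ (λ g → X g (s g))) ⟨
      M ^ T * (W s * M ^ Z)       ≡⟨ *-assoc (M ^ T) (W s) (M ^ Z) ⟨
      M ^ T * W s * M ^ Z         ∎)
      where
      Z = hits X s
      e : ∀ a b c → a * b * c ≡ a * c * b
      e = solve-∀
    bad-weight : ∀ s → w * 𝟙 (does (Bad? s)) ≤ M ^ T * W s
    bad-weight s = *𝟙-≤ (Bad? s) (λ bad → few-hits⇒heavy s (Bad⇒hits≤T bad))

  prod-blockWeight-bound : prod blockWeight ^ n * suc M ^ D ≤ n ^ (K * n) * M ^ (K * n) * M ^ D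
  prod-blockWeight-bound = begin
    prod blockWeight ^ n * suc M ^ D                              ≡⟨ cong₂ _*_ (sym (prod-^ʳ blockWeight n)) (prod-^ (suc M) degree) ⟨
    prod (λ g → blockWeight g ^ n) * prod (λ g → suc M ^ degree g) ≡⟨ prod-distrib-* (λ g → blockWeight g ^ n) (λ g → suc M ^ degree g) ⟨
    prod (λ g → blockWeight g ^ n * suc M ^ degree g)             ≤⟨ prod-mono-≤ block-bound ⟩
    prod (λ g → (n * M) ^ n * M ^ degree g)                       ≡⟨ prod-distrib-* (λ _ → (n * M) ^ n) (λ g → M ^ degree g) ⟩
    prod {K} (λ _ → (n * M) ^ n) * prod (λ g → M ^ degree g)      ≡⟨ cong₂ _*_ (prod-const K ((n * M) ^ n)) (prod-^ M degree) ⟩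
    ((n * M) ^ n) ^ K * M ^ D                                     ≡⟨ cong (_* M ^ D) [nM^n]^K≡n^Kn*M^Kn ⟩
    n ^ (K * n) * M ^ (K * n) * M ^ D                             ∎
    where
    open ≤-Reasoning
    block-bound : ∀ g → blockWeight g ^ n * suc M ^ degree g ≤ (n * M) ^ n * M ^ degree g
    block-bound g = [nM∸a]^n*[1+M]^a≤[nM]^n*M^a n M (M′ + n′ * M) (degree g) (blockWeight g) refl (degree+blockWeight≡nM g)
    [nM^n]^K≡n^Kn*M^Kn : ((n * M) ^ n) ^ K ≡ n ^ (K * n) * M ^ (K * n)
    [nM^n]^K≡n^Kn*M^Kn = trans (^-*-assoc (n * M) n K) (trans (cong ((n * M) ^_) (*-comm n K)) (^-distribʳ-* n M (K * n)))

  markov-bernoulli : #Bad ^ n * M′ ^ (T * n) * suc M ^ D ≤ M ^ (T * n) * M ^ D * n ^ (K * n)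
  markov-bernoulli = *-cancelʳ-≤ _ _ (M ^ (K * n)) {{m^n≢0 M (K * n)}} (begin
    #Bad ^ n * M′ ^ (T * n) * suc M ^ D * M ^ (K * n)             ≡⟨ e₁ (#Bad ^ n) (M′ ^ (T * n)) (suc M ^ D) (M ^ (K * n)) ⟩
    #Bad ^ n * (M′ ^ (T * n) * M ^ (K * n)) * suc M ^ D           ≡⟨ cong (λ z → #Bad ^ n * z * suc M ^ D) w^n ⟨
    #Bad ^ n * (M′ ^ T * M ^ K) ^ n * suc M ^ D                   ≤⟨ *-monoˡ-≤ (suc M ^ D) (pow-*-≤ n {#Bad} {M′ ^ T * M ^ K} {M ^ T} {prod blockWeight} exponential-markov) ⟩
    (M ^ T) ^ n * prod blockWeight ^ n * suc M ^ D                ≡⟨ *-assoc ((M ^ T) ^ n) (prod blockWeight ^ n) (suc M ^ D) ⟩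
    (M ^ T) ^ n * (prod blockWeight ^ n * suc M ^ D)              ≤⟨ *-monoʳ-≤ ((M ^ T) ^ n) prod-blockWeight-bound ⟩
    (M ^ T) ^ n * (n ^ (K * n) * M ^ (K * n) * M ^ D)             ≡⟨ cong (_* (n ^ (K * n) * M ^ (K * n) * M ^ D)) (^-*-assoc M T n) ⟩
    M ^ (T * n) * (n ^ (K * n) * M ^ (K * n) * M ^ D)             ≡⟨ e₂ (M ^ (T * n)) (n ^ (K * n)) (M ^ (K * n)) (M ^ D) ⟩
    M ^ (T * n) * M ^ D * n ^ (K * n) * M ^ (K * n)               ∎)
    where
    open ≤-Reasoning
    w^n : (M′ ^ T * M ^ K) ^ n ≡ M′ ^ (T * n) * M ^ (K * n)
    w^n = trans (^-distribʳ-* (M′ ^ T) (M ^ K) n) (cong₂ _*_ (^-*-assoc M′ T n) (^-*-assoc M K n))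
    e₁ : ∀ a b c d → a * b * c * d ≡ a * (b * d) * c
    e₁ = solve-∀
    e₂ : ∀ a b c d → a * (b * c * d) ≡ a * d * b * c
    e₂ = solve-∀

  module _ (nK<cD : n * K < c * D) where

    private
      u e : ℕ
      u = T * n
      e = D ∸ u

      cu+nK<cD : c * u + n * K < c * D
      cu+nK<cD = subst (λ z → c * z + n * K < c * D) (*-comm n T) (cnT+nK<cD nK<cD)

      u≤D : u ≤ D
      u≤D = <⇒≤ (*-cancelˡ-< c u D (≤-<-trans (m≤m+n (c * u) (n * K)) cu+nK<cD))

      u+e≡D : u + e ≡ D
      u+e≡D = m+[n∸m]≡n u≤D

      Kn<ec : K * n < e * c
      Kn<ec = +-cancelˡ-< (c * u) (K * n) (e * c) (begin-strict
        c * u + K * n    ≡⟨ cong (c * u +_) (*-comm K n) ⟩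
        c * u + n * K    <⟨ cu+nK<cD ⟩
        c * D            ≡⟨ cong (c *_) u+e≡D ⟨
        c * (u + e)      ≡⟨ *-distribˡ-+ c u e ⟩
        c * u + c * e    ≡⟨ cong (c * u +_) (*-comm c e) ⟩
        c * u + e * c    ∎)
        where open ≤-Reasoning

    markov-bernoulli′ : #Bad ^ n * R ^ u * suc M ^ e ≤ S ^ u * M ^ e * n ^ (K * n)
    markov-bernoulli′ = begin
      #Bad ^ n * R ^ u * suc M ^ e                    ≡⟨ cong (λ z → #Bad ^ n * z * suc M ^ e) (^-distribʳ-* M′ (suc M) u) ⟩
      #Bad ^ n * (M′ ^ u * suc M ^ u) * suc M ^ e     ≡⟨ e₁ (#Bad ^ n) (M′ ^ u) (suc M ^ u) (suc M ^ e) ⟩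
      #Bad ^ n * M′ ^ u * (suc M ^ u * suc M ^ e)     ≡⟨ cong (#Bad ^ n * M′ ^ u *_) (1+M^D) ⟨
      #Bad ^ n * M′ ^ u * suc M ^ D                   ≤⟨ markov-bernoulli ⟩
      M ^ u * M ^ D * n ^ (K * n)                     ≡⟨ cong (λ z → M ^ u * z * n ^ (K * n)) M^D ⟩
      M ^ u * (M ^ u * M ^ e) * n ^ (K * n)           ≡⟨ e₂ (M ^ u) (M ^ u) (M ^ e) (n ^ (K * n)) ⟩
      M ^ u * M ^ u * M ^ e * n ^ (K * n)             ≡⟨ cong (λ z → z * M ^ e * n ^ (K * n)) (^-distribʳ-* M M u) ⟨
      S ^ u * M ^ e * n ^ (K * n)                     ∎
      where
      open ≤-Reasoning
      1+M^D : suc M ^ D ≡ suc M ^ u * suc M ^ e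
      1+M^D = trans (cong (suc M ^_) (sym u+e≡D)) (^-distribˡ-+-* (suc M) u e)
      M^D : M ^ D ≡ M ^ u * M ^ e
      M^D = trans (cong (M ^_) (sym u+e≡D)) (^-distribˡ-+-* M u e)
      e₁ : ∀ a b c d → a * (b * c) * d ≡ a * b * (c * d)
      e₁ = solve-∀
      e₂ : ∀ a b c d → a * (b * c) * d ≡ a * b * c * d
      e₂ = solve-∀

    private
      [R/S]^[uc]≤[R/S]^[Knc] : R ^ (K * n * c) * S ^ (u * c) ≤ S ^ (K * n * c) * R ^ (u * c)
      [R/S]^[uc]≤[R/S]^[Knc] = x^j*y^i≤y^j*x^i (≤-trans (n≤1+n R) (≤-reflexive (sym S≡1+R)))
                                                (*-monoˡ-≤ c (≤-trans u≤D D≤K*n))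

      [M/1+M]^[ec]≤[M/1+M]^[Kn] : M ^ (e * c) * suc M ^ (K * n) ≤ suc M ^ (e * c) * M ^ (K * n)
      [M/1+M]^[ec]≤[M/1+M]^[Kn] = x^j*y^i≤y^j*x^i (n≤1+n M) (<⇒≤ Kn<ec)

      markov-bernoulli′^c : #Bad ^ (n * c) * R ^ (u * c) * suc M ^ (e * c) ≤ S ^ (u * c) * M ^ (e * c) * n ^ (K * n * c)
      markov-bernoulli′^c = subst₂ _≤_
        (trans (^-distribʳ-*₃ (#Bad ^ n) (R ^ u) (suc M ^ e) c)
               (cong₂ _*_ (cong₂ _*_ (^-*-assoc #Bad n c) (^-*-assoc R u c)) (^-*-assoc (suc M) e c)))
        (trans (^-distribʳ-*₃ (S ^ u) (M ^ e) (n ^ (K * n)) c)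
               (cong₂ _*_ (cong₂ _*_ (^-*-assoc S u c) (^-*-assoc M e c)) (^-*-assoc n (K * n) c)))
        (^-monoˡ-≤ c markov-bernoulli′)

    lower-tail-core : #Bad ^ (n * c) * R ^ (K * n * c) * suc M ^ (K * n) ≤ n ^ (K * n * c) * S ^ (K * n * c) * M ^ (K * n)
    lower-tail-core = *-cancelʳ-≤ _ _ (R ^ (u * c) * suc M ^ (e * c)) {{m*n≢0 _ _ {{m^n≢0 R (u * c)}} {{m^n≢0 (suc M) (e * c)}}}} (begin
      #Bad ^ (n * c) * R ^ (K * n * c) * suc M ^ (K * n) * (R ^ (u * c) * suc M ^ (e * c))
        ≡⟨ e₁ (#Bad ^ (n * c)) (R ^ (K * n * c)) (suc M ^ (K * n)) (R ^ (u * c)) (suc M ^ (e * c)) ⟩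
      #Bad ^ (n * c) * R ^ (u * c) * suc M ^ (e * c) * (R ^ (K * n * c) * suc M ^ (K * n))
        ≤⟨ *-monoˡ-≤ (R ^ (K * n * c) * suc M ^ (K * n)) markov-bernoulli′^c ⟩
      S ^ (u * c) * M ^ (e * c) * n ^ (K * n * c) * (R ^ (K * n * c) * suc M ^ (K * n))
        ≡⟨ e₂ (S ^ (u * c)) (M ^ (e * c)) (n ^ (K * n * c)) (R ^ (K * n * c)) (suc M ^ (K * n)) ⟩
      n ^ (K * n * c) * (R ^ (K * n * c) * S ^ (u * c)) * (M ^ (e * c) * suc M ^ (K * n))
        ≤⟨ *-mono-≤ (*-monoʳ-≤ (n ^ (K * n * c)) [R/S]^[uc]≤[R/S]^[Knc]) [M/1+M]^[ec]≤[M/1+M]^[Kn] ⟩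
      n ^ (K * n * c) * (S ^ (K * n * c) * R ^ (u * c)) * (suc M ^ (e * c) * M ^ (K * n))
        ≡⟨ e₃ (n ^ (K * n * c)) (S ^ (K * n * c)) (R ^ (u * c)) (suc M ^ (e * c)) (M ^ (K * n)) ⟩
      n ^ (K * n * c) * S ^ (K * n * c) * M ^ (K * n) * (R ^ (u * c) * suc M ^ (e * c))
        ∎)
      where
      open ≤-Reasoning
      e₁ : ∀ b r m r′ m′ → b * r * m * (r′ * m′) ≡ b * r′ * m′ * (r * m)
      e₁ = solve-∀
      e₂ : ∀ s m n r m′ → s * m * n * (r * m′) ≡ n * (r * s) * (m * m′)
      e₂ = solve-∀
      e₃ : ∀ n s r m′ m → n * (s * r) * (m′ * m) ≡ n * s * m * (r * m′)
      e₃ = solve-∀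

  private
    [x^a*y]^b : ∀ x y a b → (x ^ a * y) ^ b ≡ x ^ (b * a) * y ^ b
    [x^a*y]^b x y a b = trans (^-distribʳ-* (x ^ a) y b) (cong (_* y ^ b) (trans (^-*-assoc x a b) (cong (x ^_) (*-comm a b))))

    [#Bad^c*Q^K]^n : (#Bad ^ c * Q ^ K) ^ n ≡ #Bad ^ (n * c) * R ^ (K * n * c) * suc M ^ (K * n)
    [#Bad^c*Q^K]^n = begin
      (#Bad ^ c * Q ^ K) ^ n                         ≡⟨ ^-distribʳ-* (#Bad ^ c) (Q ^ K) n ⟩
      (#Bad ^ c) ^ n * (Q ^ K) ^ n                   ≡⟨ cong₂ _*_ (trans (^-*-assoc #Bad c n) (cong (#Bad ^_) (*-comm c n))) (^-*-assoc Q K n) ⟩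
      #Bad ^ (n * c) * (R ^ c * suc M) ^ (K * n)     ≡⟨ cong (#Bad ^ (n * c) *_) ([x^a*y]^b R (suc M) c (K * n)) ⟩
      #Bad ^ (n * c) * (R ^ (K * n * c) * suc M ^ (K * n)) ≡⟨ *-assoc (#Bad ^ (n * c)) _ _ ⟨
      #Bad ^ (n * c) * R ^ (K * n * c) * suc M ^ (K * n) ∎
      where open ≡-Reasoning

    [[n^K]^c*P^K]^n : ((n ^ K) ^ c * P ^ K) ^ n ≡ n ^ (K * n * c) * S ^ (K * n * c) * M ^ (K * n)
    [[n^K]^c*P^K]^n = begin
      ((n ^ K) ^ c * P ^ K) ^ n                      ≡⟨ ^-distribʳ-* ((n ^ K) ^ c) (P ^ K) n ⟩
      ((n ^ K) ^ c) ^ n * (P ^ K) ^ n                ≡⟨ cong₂ _*_ n^[Knc] (^-*-assoc P K n) ⟩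
      n ^ (K * n * c) * (S ^ c * M) ^ (K * n)        ≡⟨ cong (n ^ (K * n * c) *_) ([x^a*y]^b S M c (K * n)) ⟩
      n ^ (K * n * c) * (S ^ (K * n * c) * M ^ (K * n)) ≡⟨ *-assoc (n ^ (K * n * c)) _ _ ⟨
      n ^ (K * n * c) * S ^ (K * n * c) * M ^ (K * n) ∎
      where
      open ≡-Reasoning
      n^[Knc] : ((n ^ K) ^ c) ^ n ≡ n ^ (K * n * c)
      n^[Knc] = trans (^-*-assoc (n ^ K) c n) (trans (^-*-assoc n K (c * n)) (cong (n ^_) (e K n c)))
        where
        e : ∀ K n c → K * (c * n) ≡ K * n * c
        e = solve-∀

  -- Chernoff's lower tail: for a uniformly random s, Pr[hits X s < D/n − K/c]^c ≤ (P/Q)^K.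
  lower-tail : #Bad ^ c * Q ^ K ≤ (n ^ K) ^ c * P ^ K
  lower-tail with n * K <? c * D
  ... | yes nK<cD = ^-cancelʳ-≤ n (subst₂ _≤_ (sym [#Bad^c*Q^K]^n) (sym [[n^K]^c*P^K]^n) (lower-tail-core nK<cD))
  ... | no  nK≮cD = subst (λ b → b ^ c * Q ^ K ≤ (n ^ K) ^ c * P ^ K) (sym #Bad≡0) z≤n
    where
    #Bad≡0 : #Bad ≡ 0
    #Bad≡0 = n≤0⇒n≡0 (≤-trans (sumFun-mono-≤ K (λ s → ≤-reflexive (cong 𝟙 (dec-false (Bad? s) (λ bad → nK≮cD (≤-<-trans (m≤n+m (n * K) (c * (n * hits X s))) bad))))))
                               (≤-reflexive (sumFun-*ˡ K 0 (λ _ → 0))))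

-- Shifted block partitions

module Cyclic (n′ : ℕ) where

  n : ℕ
  n = suc n′

  infixl 6 _⊕_ _⊖_
  _⊕_ _⊖_ : Fin n → Fin n → Fin n
  i ⊕ j = fromℕ< (m%n<n (toℕ i + toℕ j) n)
  i ⊖ j = fromℕ< (m%n<n (toℕ i + (n ∸ toℕ j)) n)

  private
    [a%n+b]%n≡[a+b]%n : ∀ a b → (a % n + b) % n ≡ (a + b) % n
    [a%n+b]%n≡[a+b]%n a b = begin
      (a % n + b) % n             ≡⟨ %-distribˡ-+ (a % n) b n ⟩
      (a % n % n + b % n) % n     ≡⟨ cong (λ z → (z + b % n) % n) (m%n%n≡m%n a n) ⟩
      (a % n + b % n) % n         ≡⟨ %-distribˡ-+ a b n ⟨
      (a + b) % n                 ∎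
      where open ≡-Reasoning

    [i+n]%n≡i : ∀ (i : Fin n) → (toℕ i + n) % n ≡ toℕ i
    [i+n]%n≡i i = trans ([m+n]%n≡m%n (toℕ i) n) (m<n⇒m%n≡m (toℕ<n i))

  toℕ-⊕ : ∀ i j → toℕ (i ⊕ j) ≡ (toℕ i + toℕ j) % n
  toℕ-⊕ i j = toℕ-fromℕ< (m%n<n (toℕ i + toℕ j) n)

  toℕ-⊖ : ∀ i j → toℕ (i ⊖ j) ≡ (toℕ i + (n ∸ toℕ j)) % n
  toℕ-⊖ i j = toℕ-fromℕ< (m%n<n (toℕ i + (n ∸ toℕ j)) n)

  ⊖-⊕ : ∀ i j → i ⊕ j ⊖ j ≡ i
  ⊖-⊕ i j = toℕ-injective (begin
    toℕ (i ⊕ j ⊖ j)                                  ≡⟨ toℕ-⊖ (i ⊕ j) j ⟩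
    (toℕ (i ⊕ j) + (n ∸ toℕ j)) % n                  ≡⟨ cong (λ z → (z + (n ∸ toℕ j)) % n) (toℕ-⊕ i j) ⟩
    ((toℕ i + toℕ j) % n + (n ∸ toℕ j)) % n          ≡⟨ [a%n+b]%n≡[a+b]%n (toℕ i + toℕ j) (n ∸ toℕ j) ⟩
    (toℕ i + toℕ j + (n ∸ toℕ j)) % n                ≡⟨ cong (_% n) (+-assoc (toℕ i) (toℕ j) (n ∸ toℕ j)) ⟩
    (toℕ i + (toℕ j + (n ∸ toℕ j))) % n              ≡⟨ cong (λ z → (toℕ i + z) % n) (m+[n∸m]≡n (<⇒≤ (toℕ<n j))) ⟩
    (toℕ i + n) % n                                  ≡⟨ [i+n]%n≡i i ⟩
    toℕ i                                            ∎)
    where open ≡-Reasoning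

  ⊕-⊖ : ∀ i j → i ⊖ j ⊕ j ≡ i
  ⊕-⊖ i j = toℕ-injective (begin
    toℕ (i ⊖ j ⊕ j)                                  ≡⟨ toℕ-⊕ (i ⊖ j) j ⟩
    (toℕ (i ⊖ j) + toℕ j) % n                        ≡⟨ cong (λ z → (z + toℕ j) % n) (toℕ-⊖ i j) ⟩
    ((toℕ i + (n ∸ toℕ j)) % n + toℕ j) % n          ≡⟨ [a%n+b]%n≡[a+b]%n (toℕ i + (n ∸ toℕ j)) (toℕ j) ⟩
    (toℕ i + (n ∸ toℕ j) + toℕ j) % n                ≡⟨ cong (_% n) (+-assoc (toℕ i) (n ∸ toℕ j) (toℕ j)) ⟩
    (toℕ i + ((n ∸ toℕ j) + toℕ j)) % n              ≡⟨ cong (λ z → (toℕ i + z) % n) (m∸n+n≡m (<⇒≤ (toℕ<n j))) ⟩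
    (toℕ i + n) % n                                  ≡⟨ [i+n]%n≡i i ⟩
    toℕ i                                            ∎)
    where open ≡-Reasoning

  ⊕-comm : ∀ i j → i ⊕ j ≡ j ⊕ i
  ⊕-comm i j = toℕ-injective (trans (toℕ-⊕ i j) (trans (cong (_% n) (+-comm (toℕ i) (toℕ j))) (sym (toℕ-⊕ j i))))

  ⊖-involutive : ∀ i j → i ⊖ (i ⊖ j) ≡ j
  ⊖-involutive i j = trans (cong (_⊖ (i ⊖ j)) (trans (sym (⊕-⊖ i j)) (⊕-comm (i ⊖ j) j))) (⊖-⊕ j (i ⊖ j))

  does[k⊕x≟j]≡does[k≟j⊖x] : ∀ k x j → does (k ⊕ x ≟ j) ≡ does (k ≟ j ⊖ x)
  does[k⊕x≟j]≡does[k≟j⊖x] k x j = does-⇔ (mk⇔ (λ k⊕x≡j → trans (sym (⊖-⊕ k x)) (cong (_⊖ x) k⊕x≡j))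
                                                  (λ k≡j⊖x → trans (cong (_⊕ x) k≡j⊖x) (⊕-⊖ j x)))
                                              (k ⊕ x ≟ j) (k ≟ j ⊖ x)

  sum-∘⊖ : ∀ j (f : Fin n → ℕ) → ∑[ x < n ] f (j ⊖ x) ≡ sum f
  sum-∘⊖ j f = sym (∑-permute f (permutation (j ⊖_) (j ⊖_) (⊖-involutive j) (⊖-involutive j)))

module ShiftedBlocks (K n′ : ℕ) where
  open Cyclic n′

  shift-partition : (Fin K → Fin n) → Fin (K * n) → Fin n
  shift-partition s v = remainder {K} n v ⊕ s (quotient {K} n v)

  shift-partition-combine : ∀ s g k → shift-partition s (combine g k) ≡ k ⊕ s g
  shift-partition-combine s g k = cong (λ p → proj₂ p ⊕ s (proj₁ p)) (remQuot-combine g k)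

  ∣part∣≡K : ∀ s j → ∣ part (shift-partition s) j ∣ ≡ K
  ∣part∣≡K s j = begin
    ∣ part (shift-partition s) j ∣                                      ≡⟨ count-tabulate (λ v → does (shift-partition s v ≟ j)) ⟩
    ∑[ v < K * n ] 𝟙 (does (shift-partition s v ≟ j))                   ≡⟨ sum-combine K n (λ v → 𝟙 (does (shift-partition s v ≟ j))) ⟩
    ∑[ g < K ] ∑[ k < n ] 𝟙 (does (shift-partition s (combine g k) ≟ j)) ≡⟨ sum-cong-≗ {K} (λ g → sum-cong-≗ (λ k → cong 𝟙 (in-part g k))) ⟩
    ∑[ g < K ] ∑[ k < n ] 𝟙 (does (k ≟ j ⊖ s g) ∧ true)                 ≡⟨ sum-cong-≗ {K} (λ g → sum-≟∧ (j ⊖ s g) (λ _ → true)) ⟩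
    ∑[ g < K ] 1                                                         ≡⟨ trans (sum-const K 1) (*-identityʳ K) ⟩
    K                                                                    ∎
    where
    open ≡-Reasoning
    in-part : ∀ g k → does (shift-partition s (combine g k) ≟ j) ≡ does (k ≟ j ⊖ s g) ∧ true
    in-part g k = trans (cong (λ i → does (i ≟ j)) (shift-partition-combine s g k))
                        (trans (does[k⊕x≟j]≡does[k≟j⊖x] k (s g) j) (sym (∧-identityʳ (does (k ≟ j ⊖ s g)))))

  -- Whether the vertex of block g that the shift x sends to part j is a neighbour of v.
  neighbourAt : Graph (K * n) → Fin (K * n) → Fin n → Fin K → Fin n → Bool
  neighbourAt G v j g x = adj G v (combine g (j ⊖ x))

  deg-part≡hits : ∀ G v s j → deg G v (part (shift-partition s) j) ≡ hits (neighbourAt G v j) s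
  deg-part≡hits G v s j = begin
    deg G v (part (shift-partition s) j)                                         ≡⟨ count-tabulate (λ y → adj G v y ∧ lookup (part (shift-partition s) j) y) ⟩
    ∑[ y < K * n ] 𝟙 (adj G v y ∧ lookup (part (shift-partition s) j) y)          ≡⟨ sum-combine K n (λ y → 𝟙 (adj G v y ∧ lookup (part (shift-partition s) j) y)) ⟩
    ∑[ g < K ] ∑[ k < n ] 𝟙 (adj G v (combine g k) ∧ lookup (part (shift-partition s) j) (combine g k))
                                                                                  ≡⟨ sum-cong-≗ {K} (λ g → sum-cong-≗ (λ k → cong 𝟙 (in-part g k))) ⟩
    ∑[ g < K ] ∑[ k < n ] 𝟙 (does (k ≟ j ⊖ s g) ∧ adj G v (combine g k))          ≡⟨ sum-cong-≗ {K} (λ g → sum-≟∧ (j ⊖ s g) (λ k → adj G v (combine g k))) ⟩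
    hits (neighbourAt G v j) s                                                    ∎
    where
    open ≡-Reasoning
    in-part : ∀ g k → adj G v (combine g k) ∧ lookup (part (shift-partition s) j) (combine g k)
                      ≡ does (k ≟ j ⊖ s g) ∧ adj G v (combine g k)
    in-part g k = begin
      adj G v (combine g k) ∧ lookup (part (shift-partition s) j) (combine g k)  ≡⟨ cong (adj G v (combine g k) ∧_) (lookup∘tabulate (λ y → does (shift-partition s y ≟ j)) (combine g k)) ⟩
      adj G v (combine g k) ∧ does (shift-partition s (combine g k) ≟ j)        ≡⟨ cong (λ i → adj G v (combine g k) ∧ does (i ≟ j)) (shift-partition-combine s g k) ⟩
      adj G v (combine g k) ∧ does (k ⊕ s g ≟ j)                                ≡⟨ cong (adj G v (combine g k) ∧_) (does[k⊕x≟j]≡does[k≟j⊖x] k (s g) j) ⟩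
      adj G v (combine g k) ∧ does (k ≟ j ⊖ s g)                                ≡⟨ ∧-comm (adj G v (combine g k)) (does (k ≟ j ⊖ s g)) ⟩
      does (k ≟ j ⊖ s g) ∧ adj G v (combine g k)                                ∎

  deg-all≡total : ∀ G v j → deg G v all ≡ total (neighbourAt G v j)
  deg-all≡total G v j = begin
    deg G v all                                          ≡⟨ count-tabulate (λ y → adj G v y ∧ lookup all y) ⟩
    ∑[ y < K * n ] 𝟙 (adj G v y ∧ lookup all y)           ≡⟨ sum-cong-≗ (λ y → cong (λ b → 𝟙 (adj G v y ∧ b)) (lookup∘tabulate (λ _ → true) y)) ⟩
    ∑[ y < K * n ] 𝟙 (adj G v y ∧ true)                   ≡⟨ sum-combine K n (λ y → 𝟙 (adj G v y ∧ true)) ⟩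
    ∑[ g < K ] ∑[ k < n ] 𝟙 (adj G v (combine g k) ∧ true) ≡⟨ sum-cong-≗ {K} (λ g → sum-cong-≗ (λ k → cong 𝟙 (∧-identityʳ (adj G v (combine g k))))) ⟩
    ∑[ g < K ] ∑[ k < n ] 𝟙 (adj G v (combine g k))       ≡⟨ sum-cong-≗ {K} (λ g → sum-∘⊖ j (λ k → 𝟙 (adj G v (combine g k)))) ⟨
    total (neighbourAt G v j)                             ∎
    where open ≡-Reasoning

B*Y<N : ∀ c {B Y N p q} .{{_ : NonZero c}} .{{N≢0 : NonZero N}} → B ^ c * q ≤ N ^ c * p → Y ^ c * p < q → B * Y < N
B*Y<N c {B} {Y} {N} {p} {q} B^cq≤N^cp Y^cp<q = ^-cancelʳ-< c (*-cancelʳ-< q ((B * Y) ^ c) (N ^ c) (begin-strict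
  (B * Y) ^ c * q        ≡⟨ cong (_* q) (^-distribʳ-* B Y c) ⟩
  B ^ c * Y ^ c * q      ≡⟨ e (B ^ c) (Y ^ c) q ⟩
  B ^ c * q * Y ^ c      ≤⟨ *-monoˡ-≤ (Y ^ c) B^cq≤N^cp ⟩
  N ^ c * p * Y ^ c      ≡⟨ e′ (N ^ c) p (Y ^ c) ⟩
  N ^ c * (Y ^ c * p)    <⟨ *-monoʳ-< (N ^ c) {{m^n≢0 N c}} Y^cp<q ⟩
  N ^ c * q              ∎))
  where
  open ≤-Reasoning
  e : ∀ a b q → a * b * q ≡ a * q * b
  e = solve-∀
  e′ : ∀ a p b → a * p * b ≡ a * (b * p)
  e′ = solve-∀

module _ (k : ℕ) where
  open Constants k

  balanced-shift : ∀ {n′ d K} .{{_ : NonZero d}} .{{_ : NonZero K}} → suc n′ ≤ 2 ^ suc (4 * d) → C₀ * d ≤ K →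
                   (G : Graph (K * suc n′)) → let open ShiftedBlocks K n′ in
                   ∃ λ s → ∀ v j → c * deg G v all ≤ c * (suc n′ * deg G v (part (shift-partition s) j)) + suc n′ * K
  balanced-shift {n′} {d} {K} n≤2^[1+4d] C₀d≤K G = balanced (sumFun-<-∃ K badPairs (λ _ → 1) few-bad-pairs)
    where
    open ShiftedBlocks K n′
    open Cyclic n′ using (n)
    module Tail v j = LowerTail k (neighbourAt G v j)
    open Tail using (#Bad; Bad?)

    #Bad*Kn²<n^K : ∀ v j → #Bad v j * (K * n * n) < n ^ K
    #Bad*Kn²<n^K v j = B*Y<N c {#Bad v j} {K * n * n} {n ^ K} {P ^ K} {Q ^ K} {{N≢0 = m^n≢0 n K}}
                         (Tail.lower-tail v j) ([Kn²]^c*P^K<Q^K {n} {d} {K} n≤2^[1+4d] C₀d≤K)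

    #Bad-sum<n^K : ∀ v → (∑[ j < n ] #Bad v j) * (K * n) < n ^ K
    #Bad-sum<n^K v = subst (_< n ^ K) (sym (*-distribʳ-sum (K * n) (#Bad v)))
      (sum-<-average (λ j → #Bad v j * (K * n)) (λ j → subst (_< n ^ K) (sym (*-assoc (#Bad v j) (K * n) n)) (#Bad*Kn²<n^K v j)))

    badPairs : (Fin K → Fin n) → ℕ
    badPairs s = ∑[ v < K * n ] ∑[ j < n ] 𝟙 (does (Bad? v j s))

    few-bad-pairs : sumFun K badPairs < sumFun K (λ _ → 1)
    few-bad-pairs = begin-strict
      sumFun K badPairs                               ≡⟨ sumFun-sum K (λ v s → ∑[ j < n ] 𝟙 (does (Bad? v j s))) ⟩
      ∑[ v < K * n ] sumFun K (λ s → ∑[ j < n ] 𝟙 (does (Bad? v j s)))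
                                                      ≡⟨ sum-cong-≗ (λ v → sumFun-sum K (λ j s → 𝟙 (does (Bad? v j s)))) ⟩
      ∑[ v < K * n ] ∑[ j < n ] #Bad v j              <⟨ sum-<-average {{m*n≢0 K n}} (λ v → ∑[ j < n ] #Bad v j) #Bad-sum<n^K ⟩
      n ^ K                                           ≡⟨ sumFun-one K n ⟨
      sumFun K (λ _ → 1)                              ∎
      where open ≤-Reasoning

    balanced : (∃ λ s → badPairs s < 1) →
               ∃ λ s → ∀ v j → c * deg G v all ≤ c * (n * deg G v (part (shift-partition s) j)) + n * K
    balanced (s , badPairs<1) = s , λ v j →
      subst₂ (λ D Z → c * D ≤ c * (n * Z) + n * K) (sym (deg-all≡total G v j)) (sym (deg-part≡hits G v s j))
             (≮⇒≥ (λ bad → <⇒≱ badPairs<1 (pair-counted {s} {v} {j} bad)))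
      where
      pair-counted : ∀ {s v j} → Tail.Bad v j s → 1 ≤ badPairs s
      pair-counted {s} {v} {j} bad = begin
        1                                                ≡⟨ cong 𝟙 (dec-true (Bad? v j s) bad) ⟨
        𝟙 (does (Bad? v j s))                            ≤⟨ f≤sum (λ j → 𝟙 (does (Bad? v j s))) j ⟩
        ∑[ j < n ] 𝟙 (does (Bad? v j s))                 ≤⟨ f≤sum (λ v → ∑[ j < n ] 𝟙 (does (Bad? v j s))) v ⟩
        badPairs s                                       ∎
        where open ≤-Reasoning

ι : ℕ → ℚᵘ
ι m = mkℚᵘ (ℤ.+ m) 0

ι-* : ∀ m n → ι (m * n) ≃ ι m *ᵘ ι n
ι-* m n = *≡* (cong (ℤ._* ℤ.+ 1) (ℤ.pos-* m n))

ι-+ : ∀ m n → ι (m + n) ≃ ι m +ᵘ ι n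
ι-+ m n = *≡* (cong (ℤ._* ℤ.+ 1) (trans (ℤ.pos-+ m n) (sym (cong₂ ℤ._+_ (ℤ.*-identityʳ (ℤ.+ m)) (ℤ.*-identityʳ (ℤ.+ n))))))

ι-mono-≤ : ∀ {m n} → m ≤ n → ι m ≤ᵘ ι n
ι-mono-≤ {m} {n} m≤n = *≤* (subst₂ ℤ._≤_ (sym (ℤ.*-identityʳ (ℤ.+ m))) (sym (ℤ.*-identityʳ (ℤ.+ n))) (ℤ.+≤+ m≤n))

ι-positive : ∀ m .{{_ : NonZero m}} → ℚᵘ.Positive (ι m)
ι-positive (suc m) = _

toℚ≡ι : ∀ m → ℚ.toℚᵘ (toℚ m) ≡ ι m
toℚ≡ι m = cong ℚ.toℚᵘ (ℚ.normalize-coprime {m} {0} (Coprime.sym (Coprime.1-coprimeTo m)))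

1/[1+_] : ℕ → ℚ
1/[1+ k ] = ℤ.+ 1 ℚ./ suc k

toℚᵘ-1/[1+k] : ∀ k → ℚ.toℚᵘ 1/[1+ k ] ≡ mkℚᵘ (ℤ.+ 1) k
toℚᵘ-1/[1+k] k = cong ℚ.toℚᵘ (ℚ.normalize-coprime {1} {k} (Coprime.1-coprimeTo (suc k)))

-- Multiplied by c n:  (a - b) K c n ≤ c D - n K ≤ c n Z.
[a-b]K≤Z : ∀ (A B : ℚᵘ) c n K D Z .{{_ : NonZero c}} .{{_ : NonZero n}} →
           A *ᵘ ι (K * n) ≤ᵘ ι D → 1ℚᵘ ≤ᵘ B *ᵘ ι c →
           c * D ≤ c * (n * Z) + n * K → (A -ᵘ B) *ᵘ ι K ≤ᵘ ι Z
[a-b]K≤Z A B c n K D Z AKn≤D 1≤Bc cD≤cnZ+nK = ℚᵘ.*-cancelʳ-≤-pos (ι (c * n)) {{ι-positive (c * n) {{m*n≢0 c n}}}} (begin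
  (A -ᵘ B) *ᵘ ι K *ᵘ ι (c * n)                             ≃⟨ ℚᵘ.*-congˡ {(A -ᵘ B) *ᵘ ι K} (ι-* c n) ⟩
  (A -ᵘ B) *ᵘ ι K *ᵘ (ι c *ᵘ ι n)                          ≃⟨ expand ⟩
  ι c *ᵘ (A *ᵘ (ι K *ᵘ ι n)) -ᵘ B *ᵘ ι c *ᵘ (ι n *ᵘ ι K)   ≤⟨ ℚᵘ.+-mono-≤ cAKn≤cD (ℚᵘ.neg-mono-≤ nK≤BcnK) ⟩
  ι c *ᵘ ι D -ᵘ 1ℚᵘ *ᵘ (ι n *ᵘ ι K)                        ≃⟨ ℚᵘ.+-cong (ℚᵘ.≃-sym (ι-* c D)) (ℚᵘ.-‿cong (ℚᵘ.≃-trans (ℚᵘ.*-identityˡ _) (ℚᵘ.≃-sym (ι-* n K)))) ⟩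
  ι (c * D) -ᵘ ι (n * K)                                   ≤⟨ ℚᵘ.+-monoˡ-≤ (-ᵘ ι (n * K)) (ι-mono-≤ cD≤cnZ+nK) ⟩
  ι (c * (n * Z) + n * K) -ᵘ ι (n * K)                     ≃⟨ ℚᵘ.+-congˡ (-ᵘ ι (n * K)) (ι-+ (c * (n * Z)) (n * K)) ⟩
  ι (c * (n * Z)) +ᵘ ι (n * K) -ᵘ ι (n * K)                ≃⟨ solve 2 (λ x y → x :+ y :- y := x) ℚᵘ.≃-refl (ι (c * (n * Z))) (ι (n * K)) ⟩
  ι (c * (n * Z))                                          ≡⟨ cong ι (trans (sym (*-assoc c n Z)) (*-comm (c * n) Z)) ⟩
  ι (Z * (c * n))                                          ≃⟨ ι-* Z (c * n) ⟩
  ι Z *ᵘ ι (c * n)                                         ∎)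
  where
  open ℚᵘ.≤-Reasoning
  open +-*-Solver
  expand : (A -ᵘ B) *ᵘ ι K *ᵘ (ι c *ᵘ ι n) ≃ ι c *ᵘ (A *ᵘ (ι K *ᵘ ι n)) -ᵘ B *ᵘ ι c *ᵘ (ι n *ᵘ ι K)
  expand = solve 5 (λ a b k c n → (a :- b) :* k :* (c :* n) := c :* (a :* (k :* n)) :- b :* c :* (n :* k))
                   ℚᵘ.≃-refl A B (ι K) (ι c) (ι n)
  cAKn≤cD : ι c *ᵘ (A *ᵘ (ι K *ᵘ ι n)) ≤ᵘ ι c *ᵘ ι D
  cAKn≤cD = ℚᵘ.*-monoʳ-≤-nonNeg (ι c) (ℚᵘ.≤-respˡ-≃ (ℚᵘ.*-congˡ {A} (ι-* K n)) AKn≤D)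
  nK≤BcnK : 1ℚᵘ *ᵘ (ι n *ᵘ ι K) ≤ᵘ B *ᵘ ι c *ᵘ (ι n *ᵘ ι K)
  nK≤BcnK = ℚᵘ.*-monoˡ-≤-nonNeg (ι n *ᵘ ι K) {{ℚᵘ.nonNeg*nonNeg⇒nonNeg (ι n) (ι K)}} 1≤Bc

rational-bound : ∀ (a b : ℚ) k n K D Z .{{_ : NonZero n}} →
                 a ℚ.* toℚ (K * n) ℚ.≤ toℚ D → 1/[1+ k ] ℚ.< b →
                 suc k * D ≤ suc k * (n * Z) + n * K → (a ℚ.- b) ℚ.* toℚ K ℚ.≤ toℚ Z
rational-bound a b k n K D Z aKn≤D 1/c<b cD≤cnZ+nK =
  ℚ.toℚᵘ-cancel-≤ (ℚᵘ.≤-respˡ-≃ (ℚᵘ.≃-sym toℚᵘ[[a-b]K]) (subst ((A -ᵘ B) *ᵘ ι K ≤ᵘ_) (sym (toℚ≡ι Z))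
    ([a-b]K≤Z A B (suc k) n K D Z AKn≤D 1≤Bc cD≤cnZ+nK)))
  where
  A = ℚ.toℚᵘ a
  B = ℚ.toℚᵘ b
  AKn≤D : A *ᵘ ι (K * n) ≤ᵘ ι D
  AKn≤D = subst₂ _≤ᵘ_ (cong (A *ᵘ_) (toℚ≡ι (K * n))) (toℚ≡ι D)
            (ℚᵘ.≤-respˡ-≃ (ℚ.toℚᵘ-homo-* a (toℚ (K * n))) (ℚ.toℚᵘ-mono-≤ aKn≤D))
  1≤Bc : 1ℚᵘ ≤ᵘ B *ᵘ ι (suc k)
  1≤Bc = ℚᵘ.≤-respˡ-≃ (ℚᵘ.*-inverseˡ (ι (suc k)))
           (ℚᵘ.*-monoˡ-≤-nonNeg (ι (suc k)) (ℚᵘ.<⇒≤ (subst (_<ᵘ B) (toℚᵘ-1/[1+k] k) (ℚ.toℚᵘ-mono-< 1/c<b))))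
  toℚᵘ[[a-b]K] : ℚ.toℚᵘ ((a ℚ.- b) ℚ.* toℚ K) ≃ (A -ᵘ B) *ᵘ ι K
  toℚᵘ[[a-b]K] = ℚᵘ.≃-trans (ℚ.toℚᵘ-homo-* (a ℚ.- b) (toℚ K))
                   (ℚᵘ.*-cong (ℚᵘ.≃-trans (ℚ.toℚᵘ-homo-+ a (ℚ.- b)) (ℚᵘ.+-congʳ A (ℚ.toℚᵘ-homo‿- b)))
                              (ℚᵘ.≃-reflexive (toℚ≡ι K)))

lower<upper : ∀ (x : ℝ) {p q} → L x p → U x q → p ℚ.< q
lower<upper x {p} {q} Lp Uq with ℚ.<-cmp p q
... | tri< p<q _ _ = p<q
... | tri≈ _ p≡q _ = ⊥-elim (disjoint x p (Lp , subst (U x) (sym p≡q) Uq))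
... | tri> _ _ q<p = ⊥-elim (disjoint x q (L-down x q<p Lp , Uq))

archimedean : ∀ (δ : ℝ) → 0<ℝ δ → ∃ λ k → L δ 1/[1+ k ]
archimedean δ (q , 0≤q , Lq) with L-open δ Lq
... | r , q<r , Lr = k , L1/[1+k]
  where
  k = ℚᵘ.denominator-1 (ℚ.toℚᵘ r)
  1/[1+d]≤r : ∀ (x : ℚᵘ) → 0ℚᵘ <ᵘ x → mkℚᵘ (ℤ.+ 1) (ℚᵘ.denominator-1 x) ≤ᵘ x
  1/[1+d]≤r (mkℚᵘ (ℤ.+ zero) d) (*<* 0<0)  = ⊥-elim (ℤ.<-irrefl refl 0<0)
  1/[1+d]≤r (mkℚᵘ (ℤ.+ suc p) d) _         = *≤* (subst₂ ℤ._≤_ (ℤ.pos-* 1 (suc d)) (ℤ.pos-* (suc p) (suc d))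
                                               (ℤ.+≤+ (*-monoˡ-≤ (suc d) {1} {suc p} (s≤s z≤n))))
  1/[1+d]≤r (mkℚᵘ ℤ.-[1+ p ] d)  (*<* ())
  1/[1+k]≤r : 1/[1+ k ] ℚ.≤ r
  1/[1+k]≤r = ℚ.toℚᵘ-cancel-≤ (subst (_≤ᵘ ℚ.toℚᵘ r) (sym (toℚᵘ-1/[1+k] k))
                (1/[1+d]≤r (ℚ.toℚᵘ r) (ℚ.toℚᵘ-mono-< (ℚ.≤-<-trans 0≤q q<r))))
  L1/[1+k] : L δ 1/[1+ k ]
  L1/[1+k] with ℚ.<-cmp 1/[1+ k ] r
  ... | tri< 1/[1+k]<r _ _ = L-down δ 1/[1+k]<r Lr
  ... | tri≈ _ 1/[1+k]≡r _ = subst (L δ) (sym 1/[1+k]≡r) Lr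
  ... | tri> _ _ r<1/[1+k] = ⊥-elim (ℚ.<-irrefl refl (ℚ.<-≤-trans r<1/[1+k] 1/[1+k]≤r))

-- Good partitions

module _ (k : ℕ) where
  open Constants k

  shifted-partition-good : ∀ {α δ n′ d K} .{{_ : NonZero d}} .{{_ : NonZero K}} → L δ 1/[1+ k ] →
                           suc n′ ≤ 2 ^ suc (4 * d) → C₀ * d ≤ K → (G : Graph (K * suc n′)) →
                           MinDegGe G α (K * suc n′) → (H : Graph (suc n′)) → GoodPartition G H α δ
  shifted-partition-good {α} {δ} {n′} {d} {K} 1/c∈Lδ n≤2^[1+4d] C₀d≤K G δ[G]≥αN H =
    good (balanced-shift k n≤2^[1+4d] C₀d≤K G)
    where
    open ShiftedBlocks K n′
    good : (∃ λ s → ∀ v j → c * deg G v all ≤ c * (suc n′ * deg G v (part (shift-partition s) j)) + suc n′ * K) →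
           GoodPartition G H α δ
    good (s , balanced) = record
      { f     = shift-partition s
      ; m     = K
      ; size  = ∣part∣≡K s
      ; inner = λ i v _ → fair-share v i
      ; cross = λ _ j _ v _ → fair-share v j
      }
      where
      fair-share : ∀ v j → deg G v (part (shift-partition s) j) ≥[ α - δ ]· K
      fair-share v j a b a∈Lα b∈Uδ = rational-bound a b k (suc n′) K (deg G v all) (deg G v (part (shift-partition s) j))
                                       (δ[G]≥αN v a a∈Lα) (lower<upper δ 1/c∈Lδ b∈Uδ) (balanced v j)

lemma2p3 : (α δ : ℝ) → 0<ℝ δ → δ <ℝ α →
    ∃ λ (C₀ : ℕ) →
      ∀ (n d K : ℕ) → 2 ≤ n → LogLe n d → d < n → 1 ≤ K → C₀ * d ≤ K →
      (G : Graph (K * n)) → MinDegGe G α (K * n) →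
      (H : Graph n) → Regular d H →
      GoodPartition G H α δ
lemma2p3 α δ 0<δ _ with archimedean δ 0<δ
... | k , 1/c∈Lδ = Constants.C₀ k , λ where
  (suc n′) d K 2≤n logn≤d _ 1≤K C₀d≤K G δ[G]≥αN H _ →
    shifted-partition-good k {{LogLe⇒d≢0 2≤n logn≤d}} {{>-nonZero 1≤K}} 1/c∈Lδ (LogLe⇒n≤2^[1+4d] logn≤d) C₀d≤K G δ[G]≥αN H
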